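{- Let $k$ be a positive integer and let $\sigma_1,\dots,\sigma_n$ be disjoint paths, not all of length one. Then $\sigma_1,\dots,\sigma_n$ have a $k$-interlacing if and only if $|\ell(\sigma_i)-\ell(\sigma_j)|\leq 1$ for all $i\neq j$ and $n=k$. Moreover, if $P=\{\sigma_1,\dots,\sigma_k\}$ consists of $m$ paths of length $\ell$, where $0\leq m<k$, and $k-m$ paths of length $\ell-1$, then $\phi_k(P)=m!\,(k-m)!$.
   Context: For distinct $a_1,\dots,a_\ell$, the path $[a_1a_2\cdots a_\ell]$ is the partial one-to-one map sending $a_i\mapsto a_{i+1}$ for $i<\ell$ and undefined at $a_\ell$ (so $[a]$ is the nowhere-defined map on $\{a\}$); the cycle $(a_1\cdots a_\ell)$ sends $a_i\mapsto a_{i+1}$ for $i<\ell$ and $a_\ell\mapsto a_1$. Its length $\ell(\cdot)$ is $\ell$ and $a_1,\dots,a_\ell$ are its digits. Paths/cycles are disjoint if their digit sets are disjoint, and a product of disjoint paths/cycles is the partial map on the union $D$ of their digits agreeing with each one on its digits; these are elements of the symmetric inverse monoid $\mathrm{SIM}(D)$ of partial one-to-one maps $D\to D$ under composition. Given disjoint paths and/or cycles $\tau_1,\dots,\tau_r$ with union of digit sets $D$, a $k$-interlacing of them is a single path or single cycle $\beta\in\mathrm{SIM}(D)$ whose set of digits is exactly $D$ and such that $\beta^k=\tau_1\cdots\tau_r$. For a nonempty set $Q$ of disjoint paths/cycles, $\phi_k(Q)$ is the number of $k$-interlacings of the members of $Q$ (zero if there are none). -}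

module Defs where

open import Data.Nat using (ℕ; zero; suc; _≡ᵇ_; _≟_)
open import Data.Bool using (Bool; true; false; if_then_else_)
open import Data.Maybe using (Maybe; just; nothing; _>>=_)
open import Data.List using (List; []; _∷_; length; concatMap; filter; map)
open import Data.List.Membership.Propositional using (_∈_; _∉_)
open import Data.List.Relation.Unary.All using (All)
open import Data.List.Relation.Unary.Any using (Any)
open import Data.List.Relation.Unary.AllPairs using (AllPairs)
open import Data.List.Relation.Unary.Unique.Propositional using (Unique)
open import Data.Product using (Σ; _×_; ∃)
open import Relation.Binary.PropositionalEquality using (_≡_; _≢_)
open import Relation.Nullary using (¬_)
open import Function.Bundles using (_⇔_)

data Kind : Set where
  path cycle : Kind

record PC : Set where
  constructor mkPC
  field
    kind   : Kind
    digits : List ℕ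
open PC public

Valid : PC → Set
Valid σ = (digits σ ≢ []) × Unique (digits σ)

IsPath : PC → Set
IsPath σ = (kind σ ≡ path) × Valid σ

len : PC → ℕ
len σ = length (digits σ)

next : List ℕ → ℕ → Maybe ℕ
next (a ∷ b ∷ r) x = if x ≡ᵇ a then just b else next (b ∷ r) x
next _           x = nothing

firstOf : List ℕ → Maybe ℕ
firstOf []      = nothing
firstOf (a ∷ _) = just a

isLast : List ℕ → ℕ → Bool
isLast []          x = false
isLast (a ∷ [])    x = x ≡ᵇ a
isLast (_ ∷ b ∷ r) x = isLast (b ∷ r) x

sem : PC → ℕ → Maybe ℕ
sem (mkPC path ds)  x = next ds x
sem (mkPC cycle ds) x with next ds x
... | just y  = just y
... | nothing = if isLast ds x then firstOf ds else nothing

-- the product of disjoint paths/cycles (the partial map agreeing with each on its digits)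
prodSem : List PC → ℕ → Maybe ℕ
prodSem []       x = nothing
prodSem (σ ∷ σs) x with sem σ x
... | just y  = just y
... | nothing = prodSem σs x

iter : ℕ → (ℕ → Maybe ℕ) → ℕ → Maybe ℕ
iter zero    f x = just x
iter (suc k) f x = iter k f x >>= f

SameMap : PC → PC → Set
SameMap α β = ∀ x → sem α x ≡ sem β x

Disjoint : List PC → Set
Disjoint = AllPairs (λ α β → ∀ x → x ∈ digits α → x ∉ digits β)

allDigits : List PC → List ℕ
allDigits = concatMap digits

Interlacing : ℕ → List PC → PC → Set
Interlacing k Q β =
  Valid β
  × (∀ x → (x ∈ digits β) ⇔ (x ∈ allDigits Q))
  × (∀ x → iter k (sem β) x ≡ prodSem Q x)

-- φ_k(Q) = N : there are exactly N distinct (as partial maps) k-interlacings of Q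
PhiIs : ℕ → List PC → ℕ → Set
PhiIs k Q N = Σ (List PC) λ L →
  (length L ≡ N)
  × All (Interlacing k Q) L
  × AllPairs (λ α β → ¬ SameMap α β) L
  × (∀ β → Interlacing k Q β → Any (SameMap β) L)

countLen : ℕ → List PC → ℕ
countLen ℓ σs = length (filter (λ σ → len σ ≟ ℓ) σs)

module Submission where

-- If β = [b₀ b₁ ⋯ b_{N-1}] is a path,
-- βᵏ sends bᵢ ↦ b_{i+k}, so βᵏ is the product of the k "columns"
-- [bⱼ b_{j+k} b_{j+2k} ⋯] (j < k) obtained by writing b row by row into
-- k columns.  These columns have lengths n+1 (the first few) and n.

open import Data.Nat using (ℕ; zero; suc; _+_; _*_; _∸_; _≤_; _<_; _≥_; z≤n; s≤s; _≡ᵇ_; _≟_; ∣_-_∣; _!)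
open import Data.Nat.Properties
open import Data.Bool using (true; false; T)
open import Data.Unit using (tt)
open import Data.Maybe using (Maybe; just; nothing; _>>=_)
open import Data.Maybe.Properties using (just-injective)
open import Data.Fin using (Fin) renaming (_≟_ to _≟ᶠ_)
open import Data.List using (List; []; _∷_; _++_; [_]; length; lookup; map; concat; filter; drop; take; replicate; initLast; _∷ʳ′_)
open import Data.List.Properties
open import Data.List.Membership.Propositional using (_∈_; _∉_; find; lose)
open import Data.List.Membership.Propositional.Properties
open import Data.List.Membership.DecPropositional _≟_ using (_∈?_)
open import Data.List.Relation.Unary.Any using (Any; here; there)
import Data.List.Relation.Unary.Any as Any
open import Data.List.Relation.Unary.Any.Properties using (lookup-index; ¬Any[])
open import Data.List.Relation.Unary.All as All using (All; []; _∷_)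
import Data.List.Relation.Unary.All.Properties as All
open import Data.List.Relation.Unary.AllPairs as AllPairs using (AllPairs; []; _∷_)
import Data.List.Relation.Unary.AllPairs.Properties as AllPairs
open import Data.List.Relation.Unary.Unique.Propositional as Unique using (Unique)
import Data.List.Relation.Unary.Unique.Propositional.Properties as Unique
open import Data.List.Relation.Binary.Permutation.Propositional using (_↭_; ↭-refl; ↭-sym; ↭-trans; ↭-reflexive; prep; swap; ↭⇒↭ₛ)
open import Data.List.Relation.Binary.Permutation.Propositional.Properties using (∈-resp-↭; ↭-length; All-resp-↭; ++⁺ˡ; shifts)
import Data.List.Relation.Binary.Permutation.Propositional.Properties as Perm
import Data.List.Relation.Binary.Permutation.Setoid.Properties as PermSetoid
open import Data.List.Relation.Binary.BagAndSetEquality using (∼bag⇒↭)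
open import Data.List.Membership.Propositional.Properties.WithK using (unique∧set⇒bag)
open import Data.Product using (_×_; _,_; proj₁; proj₂; ∃)
open import Data.List.Extrema.Nat using (argmin; argmin-all; f[argmin]≤f[xs])
open import Data.Sum using (_⊎_; inj₁; inj₂; [_,_]′)
open import Data.Empty using (⊥; ⊥-elim)
open import Relation.Binary.PropositionalEquality hiding ([_])
open import Relation.Nullary using (¬_; Dec; yes; no)
open import Function using (id; _∘_)
open import Function.Bundles using (_⇔_; mk⇔; Equivalence)
open Equivalence using (to; from)

open import Defs

≡ᵇ-refl : ∀ a → (a ≡ᵇ a) ≡ true
≡ᵇ-refl zero    = refl
≡ᵇ-refl (suc a) = ≡ᵇ-refl a

≡ᵇ-false : ∀ x a → x ≢ a → (x ≡ᵇ a) ≡ false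
≡ᵇ-false x a x≢a with x ≡ᵇ a in eq
... | false = refl
... | true  = ⊥-elim (x≢a (≡ᵇ⇒≡ x a (subst T (sym eq) tt)))

next-skip : ∀ {x a} r → x ≢ a → next (a ∷ r) x ≡ next r x
next-skip []      _   = refl
next-skip {x} {a} (b ∷ r) x≢a rewrite ≡ᵇ-false x a x≢a = refl

next-head : ∀ a r → next (a ∷ r) a ≡ firstOf r
next-head a []      = refl
next-head a (b ∷ r) rewrite ≡ᵇ-refl a = refl

next-outside : ∀ {x} ds → x ∉ ds → next ds x ≡ nothing
next-outside []          _ = refl
next-outside (a ∷ [])    _ = refl
next-outside (a ∷ b ∷ r) x∉ =
  trans (next-skip (b ∷ r) (λ e → x∉ (here e))) (next-outside (b ∷ r) (x∉ ∘ there))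

next-image : ∀ {x y} a r → next (a ∷ r) x ≡ just y → y ∈ r
next-image a []      ()
next-image {x} a (b ∷ r) eq with x ≡ᵇ a
... | true  = here (sym (just-injective eq))
... | false = there (next-image b r eq)

next-domain : ∀ ds {y z} → next ds y ≡ just z → y ∈ ds
next-domain []      ()
next-domain (a ∷ r) {y} eq with y ≟ a
... | yes y≡a = here y≡a
... | no  y≢a = there (next-domain r (trans (sym (next-skip r y≢a)) eq))

next-codomain : ∀ ds {x y} → next ds x ≡ just y → y ∈ ds
next-codomain []      ()
next-codomain (a ∷ r) eq = there (next-image a r eq)

next-at : ∀ p x q → Unique (p ++ x ∷ q) → next (p ++ x ∷ q) x ≡ firstOf q
next-at []      x q _         = next-head x q
next-at (a ∷ p) x q (a∉ ∷ u) =
  trans (next-skip (p ++ x ∷ q) (λ x≡a → All.lookup a∉ (∈-++⁺ʳ p (here refl)) (sym x≡a)))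
        (next-at p x q u)

iter-suc : ∀ j (f : ℕ → Maybe ℕ) x → iter (suc j) f x ≡ (f x >>= iter j f)
iter-suc zero f x with f x
... | just y  = refl
... | nothing = refl
iter-suc (suc j) f x rewrite iter-suc j f x with f x
... | just y  = refl
... | nothing = refl

iter-along : ∀ p x q → Unique (p ++ x ∷ q) → ∀ j → iter j (next (p ++ x ∷ q)) x ≡ firstOf (drop j (x ∷ q))
iter-along p x q u zero = refl
iter-along p x [] u (suc j)
  rewrite iter-suc j (next (p ++ x ∷ [])) x | next-at p x [] u = sym (cong firstOf (drop-[] j))
iter-along p x (y ∷ q) u (suc j)
  rewrite iter-suc j (next (p ++ x ∷ y ∷ q)) x | next-at p x (y ∷ q) u =
  subst (λ w → iter j (next w) y ≡ firstOf (drop j (y ∷ q))) (++-assoc p [ x ] (y ∷ q))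
    (iter-along (p ++ [ x ]) y q (subst Unique (sym (++-assoc p [ x ] (y ∷ q))) u) j)

iter-outside : ∀ ds {x} k → 1 ≤ k → x ∉ ds → iter k (next ds) x ≡ nothing
iter-outside ds {x} (suc j) _ x∉ rewrite iter-suc j (next ds) x | next-outside ds x∉ = refl

isLast-outside : ∀ {x} ds → x ∉ ds → isLast ds x ≡ false
isLast-outside []          _  = refl
isLast-outside {x} (a ∷ []) x∉ = ≡ᵇ-false x a (λ e → x∉ (here e))
isLast-outside (a ∷ b ∷ r) x∉ = isLast-outside (b ∷ r) (x∉ ∘ there)

sem-outside : ∀ σ {x} → x ∉ digits σ → sem σ x ≡ nothing
sem-outside (mkPC path ds) x∉ = next-outside ds x∉
sem-outside (mkPC cycle ds) {x} x∉ with next ds x | next-outside ds x∉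
... | .nothing | refl rewrite isLast-outside ds x∉ = refl

sem-domain : ∀ σ {x y} → sem σ x ≡ just y → x ∈ digits σ
sem-domain σ {x} eq with x ∈? digits σ
... | yes x∈ = x∈
... | no  x∉ with trans (sym eq) (sem-outside σ x∉)
... | ()

sem-path : ∀ σ → kind σ ≡ path → ∀ x → sem σ x ≡ next (digits σ) x
sem-path (mkPC path ds) refl x = refl

isLast-undefined : ∀ cs {y} → y ∈ cs → next cs y ≡ nothing → isLast cs y ≡ true
isLast-undefined (a ∷ [])    {y} (here refl) _ = ≡ᵇ-refl y
isLast-undefined (a ∷ b ∷ r) {y} y∈ eq with y ≟ a
... | yes refl with trans (sym (next-head y (b ∷ r))) eq
...   | ()
isLast-undefined (a ∷ b ∷ r) (here y≡a) eq | no y≢a = ⊥-elim (y≢a y≡a)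
isLast-undefined (a ∷ b ∷ r) (there y∈) eq | no y≢a =
  isLast-undefined (b ∷ r) y∈ (trans (sym (next-skip (b ∷ r) y≢a)) eq)

cycle-total : ∀ cs {y} → y ∈ cs → ∃ λ z → (sem (mkPC cycle cs) y ≡ just z) × z ∈ cs
cycle-total cs {y} y∈ with next cs y in eq
... | just z = z , refl , next-codomain cs eq
cycle-total (c ∷ cs) y∈ | nothing rewrite isLast-undefined (c ∷ cs) y∈ eq = c , refl , here refl

iter-total : ∀ (f : ℕ → Maybe ℕ) cs → (∀ {y} → y ∈ cs → ∃ λ z → (f y ≡ just z) × z ∈ cs)
           → ∀ {x} → x ∈ cs → ∀ j → ∃ λ z → (iter j f x ≡ just z) × z ∈ cs
iter-total f cs total x∈ zero = _ , refl , x∈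
iter-total f cs total x∈ (suc j) with iter-total f cs total x∈ j
... | z , eq , z∈ with total z∈
... | w , eq′ , w∈ = w , trans (cong (_>>= f) eq) eq′ , w∈

orElse : Maybe ℕ → Maybe ℕ → Maybe ℕ
orElse (just y) _ = just y
orElse nothing  m = m

prodSem-cons : ∀ σ P x → prodSem (σ ∷ P) x ≡ orElse (sem σ x) (prodSem P x)
prodSem-cons σ P x with sem σ x
... | just y  = refl
... | nothing = refl

DigitDisjoint : List PC → Set
DigitDisjoint P = ∀ {σ τ x} → σ ∈ P → τ ∈ P → x ∈ digits σ → x ∈ digits τ → σ ≡ τ

disjoint⇒digitDisjoint : ∀ {P} → Disjoint P → DigitDisjoint P
disjoint⇒digitDisjoint (h ∷ t) (here refl) (here refl)  _   _   = refl
disjoint⇒digitDisjoint (h ∷ t) (here refl) (there τ∈)   xσ  xτ  = ⊥-elim (All.lookup h τ∈ _ xσ xτ)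
disjoint⇒digitDisjoint (h ∷ t) (there σ∈)  (here refl)  xσ  xτ  = ⊥-elim (All.lookup h σ∈ _ xτ xσ)
disjoint⇒digitDisjoint (h ∷ t) (there σ∈)  (there τ∈)   xσ  xτ  = disjoint⇒digitDisjoint t σ∈ τ∈ xσ xτ

digitDisjoint-⊆ : ∀ {P Q} → DigitDisjoint Q → (∀ {σ} → σ ∈ P → σ ∈ Q) → DigitDisjoint P
digitDisjoint-⊆ dd P⊆Q σ∈ τ∈ = dd (P⊆Q σ∈) (P⊆Q τ∈)

member-with-digit : ∀ P {x} → x ∈ allDigits P → ∃ λ τ → τ ∈ P × x ∈ digits τ
member-with-digit (σ ∷ P) x∈ with ∈-++⁻ (digits σ) x∈
... | inj₁ xσ = σ , here refl , xσ
... | inj₂ xP with member-with-digit P xP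
...   | τ , τ∈ , xτ = τ , there τ∈ , xτ

digit-of-member : ∀ P {x τ} → τ ∈ P → x ∈ digits τ → x ∈ allDigits P
digit-of-member (σ ∷ P) (here refl) x∈ = ∈-++⁺ˡ x∈
digit-of-member (σ ∷ P) (there τ∈)  x∈ = ∈-++⁺ʳ (digits σ) (digit-of-member P τ∈ x∈)

prodSem-outside : ∀ P {x} → x ∉ allDigits P → prodSem P x ≡ nothing
prodSem-outside []      _  = refl
prodSem-outside (σ ∷ P) {x} x∉ rewrite prodSem-cons σ P x | sem-outside σ (x∉ ∘ ∈-++⁺ˡ) =
  prodSem-outside P (x∉ ∘ ∈-++⁺ʳ (digits σ))

prodSem-member : ∀ P {σ x} → DigitDisjoint P → σ ∈ P → x ∈ digits σ → prodSem P x ≡ sem σ x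
prodSem-member (π ∷ P) {σ} {x} dd (here refl) x∈ rewrite prodSem-cons π P x with sem π x in eq
... | just y  = refl
... | nothing with x ∈? allDigits P
...   | no  x∉  = prodSem-outside P x∉
...   | yes x∈P with member-with-digit P x∈P
...     | τ , τ∈ , xτ with dd (here refl) (there τ∈) x∈ xτ
...       | refl = trans (prodSem-member P (λ a b → dd (there a) (there b)) τ∈ xτ) eq
prodSem-member (π ∷ P) {σ} {x} dd (there σ∈) x∈ rewrite prodSem-cons π P x with sem π x in eq
... | nothing = prodSem-member P (λ a b → dd (there a) (there b)) σ∈ x∈
... | just y with dd (here refl) (there σ∈) (sem-domain π eq) x∈
...   | refl = sym eq

prodSem-defined : ∀ P {x z} → prodSem P x ≡ just z → ∃ λ π → π ∈ P × sem π x ≡ just z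
prodSem-defined []      ()
prodSem-defined (π ∷ P) {x} eq with sem π x in eqπ
... | just y  = π , here refl , trans eqπ eq
... | nothing with prodSem-defined P eq
...   | τ , τ∈ , eqτ = τ , there τ∈ , eqτ

prodSem-cong : ∀ P Q → DigitDisjoint P → DigitDisjoint Q
             → (∀ {σ} → σ ∈ P → σ ∈ Q) → (∀ {σ} → σ ∈ Q → σ ∈ P) → ∀ x → prodSem P x ≡ prodSem Q x
prodSem-cong P Q ddP ddQ P⊆Q Q⊆P x with x ∈? allDigits P
... | yes x∈ with member-with-digit P x∈
...   | τ , τ∈ , xτ = trans (prodSem-member P ddP τ∈ xτ) (sym (prodSem-member Q ddQ (P⊆Q τ∈) xτ))
prodSem-cong P Q ddP ddQ P⊆Q Q⊆P x | no x∉ with x ∈? allDigits Q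
... | no  x∉Q = trans (prodSem-outside P x∉) (sym (prodSem-outside Q x∉Q))
... | yes x∈Q with member-with-digit Q x∈Q
...   | τ , τ∈ , xτ = ⊥-elim (x∉ (digit-of-member P (Q⊆P τ∈) xτ))

tails-agree : ∀ h s t → Unique (h ∷ s) → Unique (h ∷ t)
            → (∀ x → x ∈ h ∷ s → x ∈ h ∷ t → next (h ∷ s) x ≡ next (h ∷ t) x) → s ≡ t
tails-agree h []      []      _ _ _ = refl
tails-agree h []      (y ∷ t) _ _ agree with trans (agree h (here refl) (here refl)) (next-head h (y ∷ t))
... | ()
tails-agree h (y ∷ s) []      _ _ agree with trans (sym (next-head h (y ∷ s))) (agree h (here refl) (here refl))
... | ()
tails-agree h (y ∷ s) (y′ ∷ t) us@(_ ∷ us′) ut@(_ ∷ ut′) agree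
  with just-injective (trans (sym (next-head h (y ∷ s))) (trans (agree h (here refl) (here refl)) (next-head h (y′ ∷ t))))
... | refl = cong (y ∷_) (tails-agree y s t us′ ut′ agree′)
  where
  h∉s : h ∉ y ∷ s
  h∉s = Unique.Unique[x∷xs]⇒x∉xs us
  h∉t : h ∉ y ∷ t
  h∉t = Unique.Unique[x∷xs]⇒x∉xs ut
  agree′ : ∀ x → x ∈ y ∷ s → x ∈ y ∷ t → next (y ∷ s) x ≡ next (y ∷ t) x
  agree′ x xs xt = trans (sym (next-skip (y ∷ s) (λ e → h∉s (subst (_∈ y ∷ s) e xs))))
                  (trans (agree x (there xs) (there xt)) (next-skip (y ∷ t) (λ e → h∉t (subst (_∈ y ∷ t) e xt))))

starts-with : ∀ {h} t → Unique t → h ∈ t → (∀ y → next t y ≡ just h → ⊥) → ∃ λ t′ → t ≡ h ∷ t′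
starts-with (a ∷ t) u        (here refl) _ = t , refl
starts-with (a ∷ t) (a∉ ∷ u) (there h∈) notImage
  with starts-with t u h∈ (λ y e → notImage y (trans (next-skip t (λ y≡a → All.lookup a∉ (next-domain t e) (sym y≡a))) e))
... | t′ , refl = ⊥-elim (notImage a (next-head a (_ ∷ t′)))

first-not-image : ∀ P {h s} → All IsPath P → DigitDisjoint P → mkPC path (h ∷ s) ∈ P
                → ∀ y → prodSem P y ≡ just h → ⊥
first-not-image P {h} {s} paths dd σ∈ y eq with prodSem-defined P eq
... | mkPC κ ds , π∈ , semπ with All.lookup paths π∈
...   | refl , _ with dd σ∈ π∈ (here refl) (next-codomain ds semπ)
...     | refl = Unique.Unique[x∷xs]⇒x∉xs (proj₂ (proj₂ (All.lookup paths σ∈))) (next-image h s semπ)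

factor-unique : ∀ P Q → All IsPath P → All IsPath Q → DigitDisjoint P → DigitDisjoint Q
              → (∀ x → prodSem P x ≡ prodSem Q x) → (∀ x → x ∈ allDigits P → x ∈ allDigits Q)
              → ∀ {σ} → σ ∈ P → σ ∈ Q
factor-unique P Q pathsP pathsQ ddP ddQ same cover {mkPC _ []} σ∈ =
  ⊥-elim (proj₁ (proj₂ (All.lookup pathsP σ∈)) refl)
factor-unique P Q pathsP pathsQ ddP ddQ same cover {mkPC _ (h ∷ s)} σ∈ with All.lookup pathsP σ∈
... | refl , _ , u with member-with-digit Q (cover h (digit-of-member P σ∈ (here refl)))
...   | mkPC _ t , τ∈ , h∈t with All.lookup pathsQ τ∈
...     | refl , _ , ut
  with starts-with t ut h∈t (λ y e → first-not-image P pathsP ddP σ∈ y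
                                       (trans (same y) (trans (prodSem-member Q ddQ τ∈ (next-domain t e)) e)))
...       | t′ , refl =
  subst (_∈ Q) (cong (λ z → mkPC path (h ∷ z)) (sym (tails-agree h s t′ u ut
    (λ x xs xt → trans (sym (prodSem-member P ddP σ∈ xs)) (trans (same x) (prodSem-member Q ddQ τ∈ xt)))))) τ∈

nonempty-⊆ : ∀ {b b′ : List ℕ} → b ≢ [] → (∀ {z} → z ∈ b → z ∈ b′) → b′ ≢ []
nonempty-⊆ {[]}    b≢[] _    = ⊥-elim (b≢[] refl)
nonempty-⊆ {h ∷ _} _    b⊆b′ refl with b⊆b′ (here refl)
... | ()

path-determined : ∀ b b′ → b ≢ [] → Unique b → Unique b′ → (∀ {z} → z ∈ b → z ∈ b′)
                → (∀ x → next b x ≡ next b′ x) → b ≡ b′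
path-determined b b′ b≢[] ub ub′ b⊆b′ same
  with factor-unique [ mkPC path b ] [ mkPC path b′ ] ((refl , b≢[] , ub) ∷ []) ((refl , b′≢[] , ub′) ∷ [])
         single single (λ x → trans (prodSem-single b x) (trans (same x) (sym (prodSem-single b′ x))))
         (λ x x∈ → ∈-++⁺ˡ (b⊆b′ (subst (x ∈_) (++-identityʳ b) x∈))) (here refl)
  where
  b′≢[] : b′ ≢ []
  b′≢[] = nonempty-⊆ b≢[] b⊆b′
  single : ∀ {σ} → DigitDisjoint [ σ ]
  single (here refl) (here refl) _ _ = refl
  prodSem-single : ∀ ds x → prodSem [ mkPC path ds ] x ≡ next ds x
  prodSem-single ds x with next ds x
  ... | just y  = refl
  ... | nothing = refl
... | here refl = refl

pathsOf : List (List ℕ) → List PC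
pathsOf = map (mkPC path)

stackRow : List ℕ → List (List ℕ) → List (List ℕ)
stackRow (r ∷ R) (c ∷ A) = (r ∷ c) ∷ stackRow R A
stackRow _       _       = []

allDigits-pathsOf : ∀ A → allDigits (pathsOf A) ≡ concat A
allDigits-pathsOf []      = refl
allDigits-pathsOf (c ∷ A) = cong (c ++_) (allDigits-pathsOf A)

digits-pathsOf : ∀ A → map digits (pathsOf A) ≡ A
digits-pathsOf []      = refl
digits-pathsOf (c ∷ A) = cong (c ∷_) (digits-pathsOf A)

pathsOf-digits : ∀ p → All IsPath p → pathsOf (map digits p) ≡ p
pathsOf-digits []                  _                = refl
pathsOf-digits (mkPC _ ds ∷ p) ((refl , _) ∷ ps) = cong (mkPC path ds ∷_) (pathsOf-digits p ps)

-- Columns k A b: writing the word b row by row into k columns gives the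
-- columns A.  The last (possibly partial) row R puts one digit into each
-- of the first |R| columns; every other row is a full row of k digits
-- placed on top of the columns of the rest of the word.
data Columns (k : ℕ) : List (List ℕ) → List ℕ → Set where
  lastRow : ∀ R → length R ≤ k → Columns k (map [_] R ++ replicate (k ∸ length R) []) R
  fullRow : ∀ R {A b} → length R ≡ k → Columns k A b → Columns k (stackRow R A) (R ++ b)

length-stackRow : ∀ (R : List ℕ) A → length R ≡ length A → length (stackRow R A) ≡ length R
length-stackRow []      A       _ = refl
length-stackRow (r ∷ R) []      ()
length-stackRow (r ∷ R) (a ∷ A) e = cong suc (length-stackRow R A (suc-injective e))

columns-length : ∀ {k A b} → Columns k A b → length A ≡ k
columns-length {k} (lastRow R R≤k) =
  trans (length-++ (map [_] R))
        (trans (cong₂ _+_ (length-map [_] R) (length-replicate (k ∸ length R))) (m+[n∸m]≡n R≤k))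
columns-length (fullRow R {A} e w) = trans (length-stackRow R A (trans e (sym (columns-length w)))) e

concat-lastRow : ∀ (R : List ℕ) n → concat (map [_] R ++ replicate n []) ≡ R
concat-lastRow []      zero    = refl
concat-lastRow []      (suc n) = concat-lastRow [] n
concat-lastRow (r ∷ R) n       = cong (r ∷_) (concat-lastRow R n)

concat-stackRow : ∀ (R : List ℕ) A → length R ≡ length A → concat (stackRow R A) ↭ R ++ concat A
concat-stackRow []      []      _ = ↭-refl
concat-stackRow (r ∷ R) (a ∷ A) e =
  prep r (↭-trans (++⁺ˡ a (concat-stackRow R A (suc-injective e))) (shifts a R))

columns-↭ : ∀ {k A b} → Columns k A b → b ↭ concat A
columns-↭ {k} (lastRow R _) = ↭-reflexive (sym (concat-lastRow R (k ∸ length R)))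
columns-↭ (fullRow R {A} e w) =
  ↭-trans (++⁺ˡ R (columns-↭ w)) (↭-sym (concat-stackRow R A (trans e (sym (columns-length w)))))

headAt : List (List ℕ) → ℕ → Maybe ℕ
headAt []      i       = nothing
headAt (c ∷ A) zero    = firstOf c
headAt (c ∷ A) (suc i) = headAt A i

headAt-empty : ∀ n i → headAt (replicate n []) i ≡ nothing
headAt-empty zero    i       = refl
headAt-empty (suc n) zero    = refl
headAt-empty (suc n) (suc i) = headAt-empty n i

headAt-lastRow : ∀ R n i → firstOf (drop i R) ≡ headAt (map [_] R ++ replicate n []) i
headAt-lastRow []      n       i       = trans (cong firstOf (drop-[] i)) (sym (headAt-empty n i))
headAt-lastRow (r ∷ R) n       zero    = refl
headAt-lastRow (r ∷ R) n       (suc i) = headAt-lastRow R n i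

headAt-fullRow : ∀ R A b i → length R ≡ length A → i < length R
               → firstOf (drop i (R ++ b)) ≡ headAt (stackRow R A) i
headAt-fullRow (r ∷ R) (a ∷ A) b zero    e _         = refl
headAt-fullRow (r ∷ R) (a ∷ A) b (suc i) e (s≤s i<R) = headAt-fullRow R A b i (suc-injective e) i<R

-- The first row of the word consists of the first digits of the columns;
-- this lets distinct column lists be told apart.
columns-head : ∀ {k A b} → Columns k A b → ∀ i → i < k → firstOf (drop i b) ≡ headAt A i
columns-head {k} (lastRow R _) i _ = headAt-lastRow R (k ∸ length R) i
columns-head (fullRow R {A} {b} e w) i i<k =
  headAt-fullRow R A b i (trans e (sym (columns-length w))) (subst (i <_) (sym e) i<k)

columns-nonempty : ∀ {k A b} → Columns k A b → k ≤ length b → All (_≢ []) A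
columns-nonempty {k} (lastRow R _) k≤R rewrite m≤n⇒m∸n≡0 k≤R = singletons R
  where
  singletons : ∀ (R : List ℕ) → All (_≢ []) (map [_] R ++ [])
  singletons []      = []
  singletons (r ∷ R) = (λ ()) ∷ singletons R
columns-nonempty (fullRow R {A} _ _) _ = nonempty R A
  where
  nonempty : ∀ R A → All (_≢ []) (stackRow R A)
  nonempty (r ∷ R) (a ∷ A) = (λ ()) ∷ nonempty R A
  nonempty []      _       = []
  nonempty (_ ∷ _) []      = []

prodSem-lastRow : ∀ R n x → prodSem (pathsOf (map [_] R ++ replicate n [])) x ≡ nothing
prodSem-lastRow []      zero    x = refl
prodSem-lastRow []      (suc n) x = prodSem-lastRow [] n x
prodSem-lastRow (r ∷ R) n       x = prodSem-lastRow R n x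

prodSem-stack-outside : ∀ R A x → x ∉ R → x ∉ concat A → prodSem (pathsOf (stackRow R A)) x ≡ nothing
prodSem-stack-outside (r ∷ R) (a ∷ A) x x∉R x∉A
  rewrite prodSem-cons (mkPC path (r ∷ a)) (pathsOf (stackRow R A)) x
        | next-outside {x} (r ∷ a) (λ { (here e) → x∉R (here e) ; (there x∈a) → x∉A (∈-++⁺ˡ x∈a) }) =
  prodSem-stack-outside R A x (x∉R ∘ there) (x∉A ∘ ∈-++⁺ʳ a)
prodSem-stack-outside []      _ x _ _ = refl
prodSem-stack-outside (_ ∷ _) [] x _ _ = refl

prodSem-stack-below : ∀ R A x → length R ≡ length A → x ∉ R
                    → prodSem (pathsOf (stackRow R A)) x ≡ prodSem (pathsOf A) x
prodSem-stack-below []      []      x _ _ = refl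
prodSem-stack-below (r ∷ R) (a ∷ A) x e x∉R
  rewrite prodSem-cons (mkPC path (r ∷ a)) (pathsOf (stackRow R A)) x
        | prodSem-cons (mkPC path a) (pathsOf A) x
        | next-skip {x} {r} a (λ e → x∉R (here e))
        | prodSem-stack-below R A x (suc-injective e) (x∉R ∘ there) = refl

prodSem-stack-at : ∀ R₁ x R₂ A → length (R₁ ++ x ∷ R₂) ≡ length A → x ∉ R₁ → x ∉ R₂ → x ∉ concat A
                 → prodSem (pathsOf (stackRow (R₁ ++ x ∷ R₂) A)) x ≡ headAt A (length R₁)
prodSem-stack-at [] x R₂ (a ∷ A) e _ x∉R₂ x∉A
  rewrite prodSem-cons (mkPC path (x ∷ a)) (pathsOf (stackRow R₂ A)) x | next-head x a with a
... | []     = prodSem-stack-outside R₂ A x x∉R₂ x∉A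
... | y ∷ a′ = refl
prodSem-stack-at (r ∷ R₁) x R₂ (a ∷ A) e x∉R₁ x∉R₂ x∉A
  rewrite prodSem-cons (mkPC path (r ∷ a)) (pathsOf (stackRow (R₁ ++ x ∷ R₂) A)) x
        | next-outside {x} (r ∷ a) (λ { (here e) → x∉R₁ (here e) ; (there x∈a) → x∉A (∈-++⁺ˡ x∈a) }) =
  prodSem-stack-at R₁ x R₂ A (suc-injective e) (x∉R₁ ∘ there) x∉R₂ (x∉A ∘ ∈-++⁺ʳ a)

unique-++⁻ : ∀ (xs : List ℕ) {ys} → Unique (xs ++ ys) → Unique xs × Unique ys × (∀ {x} → x ∈ xs → x ∉ ys)
unique-++⁻ []       u        = [] , u , (λ ())
unique-++⁻ (a ∷ xs) (a∉ ∷ u) with unique-++⁻ xs u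
... | uxs , uys , apart =
  (All.++⁻ˡ xs a∉ ∷ uxs) , uys ,
  λ { (here refl) x∈ys → All.lookup (All.++⁻ʳ xs a∉) x∈ys refl ; (there x∈xs) → apart x∈xs }

drop-++-length : ∀ (xs : List ℕ) ys n → drop (length xs + n) (xs ++ ys) ≡ drop n ys
drop-++-length []       ys n = refl
drop-++-length (x ∷ xs) ys n = drop-++-length xs ys n

-- k steps from a digit x of the top row R₁ ++ x ∷ R₂ lead to position
-- |R₁| of the next row, i.e. to the first digit below x in its column.
power-on-top : ∀ {k A b} R₁ x R₂ → length (R₁ ++ x ∷ R₂) ≡ k → Columns k A b → Unique ((R₁ ++ x ∷ R₂) ++ b)
             → iter k (next ((R₁ ++ x ∷ R₂) ++ b)) x ≡ prodSem (pathsOf (stackRow (R₁ ++ x ∷ R₂) A)) x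
power-on-top {k} {A} {b} R₁ x R₂ refl w u with unique-++⁻ (R₁ ++ x ∷ R₂) u
... | uR , _ , apart with unique-++⁻ R₁ uR
...   | _ , (x∉R₂ ∷ _) , apart₁ = begin
  iter k (next ((R₁ ++ x ∷ R₂) ++ b)) x
    ≡⟨ cong (λ z → iter k (next z) x) (++-assoc R₁ (x ∷ R₂) b) ⟩
  iter k (next (R₁ ++ x ∷ R₂ ++ b)) x
    ≡⟨ iter-along R₁ x (R₂ ++ b) (subst Unique (++-assoc R₁ (x ∷ R₂) b) u) k ⟩
  firstOf (drop k (x ∷ R₂ ++ b))
    ≡⟨ cong (λ n → firstOf (drop n (x ∷ R₂ ++ b))) |R|≡ ⟩
  firstOf (drop (length R₂ + length R₁) (R₂ ++ b))
    ≡⟨ cong firstOf (drop-++-length R₂ b (length R₁)) ⟩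
  firstOf (drop (length R₁) b)
    ≡⟨ columns-head w (length R₁) (≤-trans (s≤s (m≤n+m (length R₁) (length R₂))) (≤-reflexive (sym |R|≡))) ⟩
  headAt A (length R₁)
    ≡⟨ prodSem-stack-at R₁ x R₂ A (sym (columns-length w)) (λ m → apart₁ m (here refl))
                          (λ m → All.lookup x∉R₂ m refl) (λ m → apart (∈-++⁺ʳ R₁ (here refl)) (∈-resp-↭ (↭-sym (columns-↭ w)) m)) ⟨
  prodSem (pathsOf (stackRow (R₁ ++ x ∷ R₂) A)) x ∎
  where
  open ≡-Reasoning
  |R|≡ : length (R₁ ++ x ∷ R₂) ≡ suc (length R₂ + length R₁)
  |R|≡ = trans (length-++ R₁) (trans (+-suc (length R₁) (length R₂)) (cong suc (+-comm (length R₁) (length R₂))))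

columns-power : ∀ {k A b} → 1 ≤ k → Columns k A b → Unique b → ∀ x → iter k (next b) x ≡ prodSem (pathsOf A) x
columns-power {k} k≥1 (lastRow R R≤k) u x with x ∈? R
... | no x∉ = trans (iter-outside R k k≥1 x∉) (sym (prodSem-lastRow R (k ∸ length R) x))
... | yes x∈ with ∈-∃++ x∈
...   | p , q , refl =
  trans (iter-along p x q u k)
        (trans (cong firstOf (drop-all k (x ∷ q) (≤-trans (length-++-≤ʳ (x ∷ q) {p}) R≤k)))
               (sym (prodSem-lastRow (p ++ x ∷ q) (k ∸ length (p ++ x ∷ q)) x)))
columns-power {k} k≥1 (fullRow R {A} {b} e w) u x with unique-++⁻ R u
... | _ , ub , _ with x ∈? R
...   | yes x∈R with ∈-∃++ x∈R
...     | R₁ , R₂ , refl = power-on-top R₁ x R₂ e w u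
columns-power {k} k≥1 (fullRow R {A} {b} e w) u x | _ , ub , _ | no x∉R with x ∈? b
... | no x∉b =
  trans (iter-outside (R ++ b) k k≥1 (λ m → [ x∉R , x∉b ]′ (∈-++⁻ R m)))
        (sym (prodSem-stack-outside R A x x∉R (x∉b ∘ ∈-resp-↭ (↭-sym (columns-↭ w)))))
... | yes x∈b with ∈-∃++ x∈b
...   | p , q , refl = begin
  iter k (next (R ++ p ++ x ∷ q)) x      ≡⟨ cong (λ z → iter k (next z) x) (sym (++-assoc R p (x ∷ q))) ⟩
  iter k (next ((R ++ p) ++ x ∷ q)) x    ≡⟨ iter-along (R ++ p) x q (subst Unique (sym (++-assoc R p (x ∷ q))) u) k ⟩
  firstOf (drop k (x ∷ q))               ≡⟨ iter-along p x q ub k ⟨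
  iter k (next (p ++ x ∷ q)) x           ≡⟨ columns-power k≥1 w ub x ⟩
  prodSem (pathsOf A) x                  ≡⟨ prodSem-stack-below R A x (trans e (sym (columns-length w))) x∉R ⟨
  prodSem (pathsOf (stackRow R A)) x     ∎
  where open ≡-Reasoning

Balanced : List (List ℕ) → Set
Balanced A = ∃ λ n → ∃ λ P → ∃ λ Q →
  (A ≡ P ++ Q) × All (λ c → length c ≡ suc n) P × All (λ c → length c ≡ n) Q

stack-split : ∀ R P Q → length R ≡ length P + length Q
            → stackRow R (P ++ Q) ≡ stackRow (take (length P) R) P ++ stackRow (drop (length P) R) Q
stack-split R       []      Q e = refl
stack-split (r ∷ R) (p ∷ P) Q e = cong ((r ∷ p) ∷_) (stack-split R P Q (suc-injective e))

stack-length : ∀ {m} R P → All (λ c → length c ≡ m) P → All (λ c → length c ≡ suc m) (stackRow R P)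
stack-length (r ∷ R) (p ∷ P) (e ∷ es) = cong suc e ∷ stack-length R P es
stack-length []      _       _        = []
stack-length (_ ∷ _) []      _        = []

-- The columns of a word are balanced (the last row fills the first ones).
columns-balanced : ∀ {k A b} → Columns k A b → Balanced A
columns-balanced {k} (lastRow R _) = 0 , map [_] R , replicate (k ∸ length R) [] , refl , ones R , zeros _
  where
  ones : ∀ (R : List ℕ) → All (λ c → length c ≡ 1) (map [_] R)
  ones []      = []
  ones (r ∷ R) = refl ∷ ones R
  zeros : ∀ n → All (λ (c : List ℕ) → length c ≡ 0) (replicate n [])
  zeros zero    = []
  zeros (suc n) = refl ∷ zeros n
columns-balanced (fullRow R {A} e w) with columns-balanced w | columns-length w
... | n , P , Q , refl , longP , shortQ | |A|≡k =
  suc n , stackRow (take (length P) R) P , stackRow (drop (length P) R) Q ,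
  stack-split R P Q (trans e (trans (sym |A|≡k) (length-++ P))) , stack-length _ P longP , stack-length _ Q shortQ

balanced-sorted : ∀ {A} → Balanced A → AllPairs (λ c c′ → length c′ ≤ length c) A
balanced-sorted (n , P , Q , refl , longP , shortQ) =
  AllPairs.++⁺ (equal-lengths longP) (equal-lengths shortQ)
    (All.map (λ |c|≡ → All.map (λ |c′|≡ → ≤-trans (≤-reflexive |c′|≡) (≤-trans (n≤1+n n) (≤-reflexive (sym |c|≡)))) shortQ) longP)
  where
  equal-lengths : ∀ {j} {C : List (List ℕ)} → All (λ c → length c ≡ j) C → AllPairs (λ c c′ → length c′ ≤ length c) C
  equal-lengths []       = []
  equal-lengths (e ∷ es) = All.map (λ e′ → ≤-reflexive (trans e′ (sym e))) es ∷ equal-lengths es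

heads : List (List ℕ) → List ℕ
heads []            = []
heads ([] ∷ A)      = heads A
heads ((x ∷ c) ∷ A) = x ∷ heads A

behead : List (List ℕ) → List (List ℕ)
behead = map (drop 1)

weave : ℕ → List (List ℕ) → List ℕ
weave zero    A = []
weave (suc f) A = heads A ++ weave f (behead A)

heads-lastRow : ∀ R n → heads (map [_] R ++ replicate n []) ≡ R
heads-lastRow []      zero    = refl
heads-lastRow []      (suc n) = heads-lastRow [] n
heads-lastRow (r ∷ R) n       = cong (r ∷_) (heads-lastRow R n)

behead-lastRow : ∀ (R : List ℕ) n → behead (map [_] R ++ replicate n []) ≡ replicate (length R + n) []
behead-lastRow []      zero    = refl
behead-lastRow []      (suc n) = cong ([] ∷_) (behead-lastRow [] n)
behead-lastRow (r ∷ R) n       = cong ([] ∷_) (behead-lastRow R n)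

weave-empty : ∀ f m → weave f (replicate m []) ≡ []
weave-empty zero    m = refl
weave-empty (suc f) m =
  cong₂ _++_ (heads-empty m) (trans (cong (weave f) (behead-empty m)) (weave-empty f m))
  where
  heads-empty : ∀ m → heads (replicate m []) ≡ []
  heads-empty zero    = refl
  heads-empty (suc m) = heads-empty m
  behead-empty : ∀ m → behead (replicate m []) ≡ replicate m ([] {A = ℕ})
  behead-empty zero    = refl
  behead-empty (suc m) = cong ([] ∷_) (behead-empty m)

heads-stack : ∀ R A → length R ≡ length A → heads (stackRow R A) ≡ R
heads-stack []      []      _ = refl
heads-stack (r ∷ R) (a ∷ A) e = cong (r ∷_) (heads-stack R A (suc-injective e))

behead-stack : ∀ R A → length R ≡ length A → behead (stackRow R A) ≡ A
behead-stack []      []      _ = refl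
behead-stack (r ∷ R) (a ∷ A) e = cong (a ∷_) (behead-stack R A (suc-injective e))

columns-weave : ∀ {k A b} → 1 ≤ k → Columns k A b → ∀ f → length b ≤ f → weave f A ≡ b
columns-weave _ (lastRow R _) zero R≤0 = empty R R≤0
  where
  empty : ∀ (R : List ℕ) → length R ≤ 0 → [] ≡ R
  empty []      _  = refl
  empty (_ ∷ _) ()
columns-weave {k} _ (lastRow R _) (suc f) _ =
  trans (cong₂ _++_ (heads-lastRow R (k ∸ length R))
                    (trans (cong (weave f) (behead-lastRow R _)) (weave-empty f _)))
        (++-identityʳ R)
columns-weave {k} k≥1 (fullRow R e w) zero R++b≤0 =
  ⊥-elim (<⇒≱ (≤-trans k≥1 (≤-trans (≤-reflexive (sym e)) (≤-trans (length-++-≤ˡ R) R++b≤0))) z≤n)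
columns-weave {k} k≥1 (fullRow R {A} {b} e w) (suc f) R++b≤1+f =
  cong₂ _++_ (heads-stack R A |R|≡|A|) (trans (cong (weave f) (behead-stack R A |R|≡|A|)) (columns-weave k≥1 w f b≤f))
  where
  |R|≡|A| = trans e (sym (columns-length w))
  b≤f : length b ≤ f
  b≤f = ≤-pred (≤-trans (+-monoˡ-≤ (length b) (≤-trans k≥1 (≤-reflexive (sym e))))
                        (≤-trans (≤-reflexive (sym (length-++ R))) R++b≤1+f))

columns-exist : ∀ k → 1 ≤ k → ∀ b → ∃ λ A → Columns k A b
columns-exist k k≥1 b = go (length b) b ≤-refl
  where
  go : ∀ f b → length b ≤ f → ∃ λ A → Columns k A b
  go f b b≤f with length b ≤? k
  ... | yes b≤k = _ , lastRow b b≤k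
  go zero    b b≤0   | no b≰k = ⊥-elim (b≰k (≤-trans b≤0 z≤n))
  go (suc f) b b≤1+f | no b≰k with go f (drop k b) rest≤f
    where
    rest≤f : length (drop k b) ≤ f
    rest≤f = begin
      length (drop k b) ≡⟨ length-drop k b ⟩
      length b ∸ k      ≤⟨ ∸-monoʳ-≤ (length b) k≥1 ⟩
      length b ∸ 1      ≤⟨ ∸-monoˡ-≤ 1 b≤1+f ⟩
      f                 ∎
      where open ≤-Reasoning
  ... | A , w = _ , subst (Columns k _) (take++drop≡id k b)
                    (fullRow (take k b) (trans (length-take k b) (m≤n⇒m⊓n≡m (≰⇒≥ b≰k))) w)

singletons-heads : ∀ P → All (λ c → length c ≡ 1) P → P ≡ map [_] (heads P)
singletons-heads []              _        = refl
singletons-heads ((x ∷ []) ∷ P) (_ ∷ es) = cong ([ x ] ∷_) (singletons-heads P es)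

empties : ∀ (Q : List (List ℕ)) → All (λ c → length c ≡ 0) Q → Q ≡ replicate (length Q) []
empties []       _        = refl
empties ([] ∷ Q) (_ ∷ es) = cong ([] ∷_) (empties Q es)

stack-heads : ∀ {m} P → All (λ c → length c ≡ suc m) P → P ≡ stackRow (heads P) (behead P)
stack-heads []            _        = refl
stack-heads ((x ∷ c) ∷ P) (_ ∷ es) = cong ((x ∷ c) ∷_) (stack-heads P es)

length-heads : ∀ {m} P → All (λ c → length c ≡ suc m) P → length (heads P) ≡ length P
length-heads []            _        = refl
length-heads ((x ∷ c) ∷ P) (_ ∷ es) = cong suc (length-heads P es)

behead-length : ∀ {m} P → All (λ c → length c ≡ suc m) P → All (λ c → length c ≡ m) (behead P)
behead-length []            _        = []
behead-length ((x ∷ c) ∷ P) (e ∷ es) = suc-injective e ∷ behead-length P es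

stack-++ : ∀ R₁ R₂ P₁ P₂ → length R₁ ≡ length P₁
         → stackRow (R₁ ++ R₂) (P₁ ++ P₂) ≡ stackRow R₁ P₁ ++ stackRow R₂ P₂
stack-++ []       R₂ []       P₂ _ = refl
stack-++ (r ∷ R₁) R₂ (p ∷ P₁) P₂ e = cong ((r ∷ p) ∷_) (stack-++ R₁ R₂ P₁ P₂ (suc-injective e))

balanced-woven : ∀ k n P Q → All (λ c → length c ≡ suc n) P → All (λ c → length c ≡ n) Q
               → length P + length Q ≡ k → ∃ λ b → Columns k (P ++ Q) b
balanced-woven k zero P Q longP shortQ |P|+|Q|≡k =
  heads P , subst (λ A → Columns k A (heads P)) (sym P++Q≡) (lastRow (heads P) |R|≤k)
  where
  |R|≡|P| : length (heads P) ≡ length P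
  |R|≡|P| = trans (sym (length-map [_] (heads P))) (cong length (sym (singletons-heads P longP)))
  |R|≤k : length (heads P) ≤ k
  |R|≤k = subst (_≤ k) (sym |R|≡|P|) (subst (length P ≤_) |P|+|Q|≡k (m≤m+n (length P) (length Q)))
  P++Q≡ : P ++ Q ≡ map [_] (heads P) ++ replicate (k ∸ length (heads P)) []
  P++Q≡ = cong₂ _++_ (singletons-heads P longP)
            (trans (empties Q shortQ) (cong (λ z → replicate z []) (sym
              (trans (cong (k ∸_) |R|≡|P|) (trans (cong (_∸ length P) (sym |P|+|Q|≡k)) (m+n∸m≡n (length P) (length Q)))))))
balanced-woven k (suc n) P Q longP shortQ |P|+|Q|≡k
  with balanced-woven k n (behead P) (behead Q) (behead-length P longP) (behead-length Q shortQ)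
         (trans (cong₂ _+_ (length-map (drop 1) P) (length-map (drop 1) Q)) |P|+|Q|≡k)
... | b , w = (heads P ++ heads Q) ++ b ,
              subst (λ A → Columns k A ((heads P ++ heads Q) ++ b)) (sym P++Q≡) (fullRow (heads P ++ heads Q) |R|≡k w)
  where
  |R|≡k : length (heads P ++ heads Q) ≡ k
  |R|≡k = trans (length-++ (heads P)) (trans (cong₂ _+_ (length-heads P longP) (length-heads Q shortQ)) |P|+|Q|≡k)
  P++Q≡ : P ++ Q ≡ stackRow (heads P ++ heads Q) (behead P ++ behead Q)
  P++Q≡ = trans (cong₂ _++_ (stack-heads P longP) (stack-heads Q shortQ))
            (sym (stack-++ (heads P) (heads Q) (behead P) (behead Q)
                           (trans (length-heads P longP) (sym (length-map (drop 1) P)))))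

module _ {A : Set} where

  unique-↭ : ∀ {xs ys : List A} → Unique xs → Unique ys
           → (∀ {z} → z ∈ xs → z ∈ ys) → (∀ {z} → z ∈ ys → z ∈ xs) → xs ↭ ys
  unique-↭ uxs uys xs⊆ys ys⊆xs = ∼bag⇒↭ (unique∧set⇒bag uxs uys (mk⇔ xs⊆ys ys⊆xs))

  unique-resp-↭ : ∀ {xs ys : List A} → xs ↭ ys → Unique xs → Unique ys
  unique-resp-↭ p = PermSetoid.Unique-resp-↭ (setoid A) (↭⇒↭ₛ p)

  concat-↭ : ∀ {xss yss : List (List A)} → xss ↭ yss → concat xss ↭ concat yss
  concat-↭ _↭_.refl        = ↭-refl
  concat-↭ (prep xs p)     = ++⁺ˡ xs (concat-↭ p)
  concat-↭ (swap xs ys p)  = ↭-trans (++⁺ˡ xs (++⁺ˡ ys (concat-↭ p))) (shifts xs ys)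
  concat-↭ (_↭_.trans p q) = ↭-trans (concat-↭ p) (concat-↭ q)

  allPairs-∈ : ∀ {R S : A → A → Set} {xs} → AllPairs R xs
             → (∀ {a b} → a ∈ xs → b ∈ xs → R a b → S a b) → AllPairs S xs
  allPairs-∈ []       _ = []
  allPairs-∈ (r ∷ rs) f = All.tabulate (λ b∈ → f (here refl) (there b∈) (All.lookup r b∈))
                          ∷ allPairs-∈ rs (λ a∈ b∈ → f (there a∈) (there b∈))

  select : List A → List (A × List A)
  select []       = []
  select (x ∷ xs) = (x , xs) ∷ map (λ (y , r) → y , x ∷ r) (select xs)

  select-↭ : ∀ {xs y r} → (y , r) ∈ select xs → xs ↭ y ∷ r
  select-↭ {x ∷ xs} (here refl) = ↭-refl
  select-↭ {x ∷ xs} (there yr∈) with ∈-map⁻ (λ (y , r) → y , x ∷ r) yr∈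
  ... | (y , r) , yr∈′ , refl = ↭-trans (prep x (select-↭ yr∈′)) (swap x y ↭-refl)

  select-complete : ∀ {xs y} → y ∈ xs → ∃ λ r → (y , r) ∈ select xs
  select-complete {x ∷ xs} (here refl) = xs , here refl
  select-complete {x ∷ xs} (there y∈) with select-complete y∈
  ... | r , yr∈ = x ∷ r , there (∈-map⁺ (λ (y , r) → y , x ∷ r) yr∈)

  length-select : ∀ xs → length (select xs) ≡ length xs
  length-select []       = refl
  length-select (x ∷ xs) = cong suc (trans (length-map _ (select xs)) (length-select xs))

  select-distinct : ∀ {xs} → Unique xs → AllPairs (λ a b → proj₁ a ≢ proj₁ b) (select xs)
  select-distinct {[]}     _          = []
  select-distinct {x ∷ xs} (x∉ ∷ u) =
    All.map⁺ (All.tabulate (λ {(y , r)} yr∈ → All.lookup x∉ (∈-resp-↭ (↭-sym (select-↭ yr∈)) (here refl))))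
      ∷ AllPairs.map⁺ (select-distinct u)

  -- permsOf n xs lists the orderings of xs, where n = length xs is the
  -- recursion bound; permsAfter n s prefixes each choice in s.
  mutual
    permsOf : ℕ → List A → List (List A)
    permsOf zero    xs = [] ∷ []
    permsOf (suc n) xs = permsAfter n (select xs)

    permsAfter : ℕ → List (A × List A) → List (List A)
    permsAfter n []            = []
    permsAfter n ((y , r) ∷ s) = map (y ∷_) (permsOf n r) ++ permsAfter n s

  perms : List A → List (List A)
  perms xs = permsOf (length xs) xs

  permsAfter⁻ : ∀ {n s p} → p ∈ permsAfter n s
              → ∃ λ y → ∃ λ r → ∃ λ p′ → ((y , r) ∈ s) × (p′ ∈ permsOf n r) × (p ≡ y ∷ p′)
  permsAfter⁻ {n} {(y , r) ∷ s} p∈ with ∈-++⁻ (map (y ∷_) (permsOf n r)) p∈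
  ... | inj₁ p∈₁ with ∈-map⁻ (y ∷_) p∈₁
  ...   | p′ , p′∈ , refl = y , r , p′ , here refl , p′∈ , refl
  permsAfter⁻ {n} {(y , r) ∷ s} p∈ | inj₂ p∈₂ with permsAfter⁻ {n} {s} p∈₂
  ... | y′ , r′ , p′ , yr∈ , p′∈ , eq = y′ , r′ , p′ , there yr∈ , p′∈ , eq

  permsAfter⁺ : ∀ {n s y r p} → (y , r) ∈ s → p ∈ permsOf n r → y ∷ p ∈ permsAfter n s
  permsAfter⁺ {n} {(y , r) ∷ s}   (here refl) p∈ = ∈-++⁺ˡ (∈-map⁺ (y ∷_) p∈)
  permsAfter⁺ {n} {(y′ , r′) ∷ s} (there yr∈) p∈ = ∈-++⁺ʳ (map (y′ ∷_) (permsOf n r′)) (permsAfter⁺ yr∈ p∈)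

  permsOf-↭ : ∀ n {xs p} → n ≡ length xs → p ∈ permsOf n xs → p ↭ xs
  permsOf-↭ zero    {[]}    _ (here refl) = ↭-refl
  permsOf-↭ (suc n) {xs}    e p∈ with permsAfter⁻ {n} {select xs} p∈
  ... | y , r , p′ , yr∈ , p′∈ , refl =
    ↭-trans (prep y (permsOf-↭ n (suc-injective (trans e (↭-length (select-↭ yr∈)))) p′∈)) (↭-sym (select-↭ yr∈))

  perms-↭ : ∀ {xs p} → p ∈ perms xs → p ↭ xs
  perms-↭ = permsOf-↭ _ refl

  mutual
    length-permsOf : ∀ n xs → n ≡ length xs → length (permsOf n xs) ≡ n !
    length-permsOf zero    xs e = refl
    length-permsOf (suc n) xs e =
      trans (length-permsAfter n (select xs) (All.tabulate (λ {(y , r)} yr∈ → suc-injective (trans e (↭-length (select-↭ yr∈))))))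
            (cong (_* n !) (trans (length-select xs) (sym e)))

    length-permsAfter : ∀ n s → All (λ (y , r) → n ≡ length r) s → length (permsAfter n s) ≡ length s * n !
    length-permsAfter n []            _        = refl
    length-permsAfter n ((y , r) ∷ s) (e ∷ es) =
      trans (length-++ (map (y ∷_) (permsOf n r)))
            (cong₂ _+_ (trans (length-map _ (permsOf n r)) (length-permsOf n r e)) (length-permsAfter n s es))

  length-perms : ∀ xs → length (perms xs) ≡ length xs !
  length-perms xs = length-permsOf (length xs) xs refl

  mutual
    permsOf-distinct : ∀ n {xs} → n ≡ length xs → Unique xs → AllPairs _≢_ (permsOf n xs)
    permsOf-distinct zero    _ _ = [] ∷ []
    permsOf-distinct (suc n) {xs} e u =
      permsAfter-distinct n (select xs) (select-distinct u)
        (All.tabulate (λ {(y , r)} yr∈ → suc-injective (trans e (↭-length (select-↭ yr∈))) ,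
                                          Unique.tail (unique-resp-↭ (select-↭ yr∈) u)))

    permsAfter-distinct : ∀ n s → AllPairs (λ a b → proj₁ a ≢ proj₁ b) s
                        → All (λ (y , r) → n ≡ length r × Unique r) s → AllPairs _≢_ (permsAfter n s)
    permsAfter-distinct n []            _        _               = []
    permsAfter-distinct n ((y , r) ∷ s) (y∉ ∷ d) ((e , ur) ∷ oks) =
      AllPairs.++⁺ (AllPairs.map⁺ (AllPairs.map (λ p≢q eq → p≢q (∷-injectiveʳ eq)) (permsOf-distinct n e ur)))
                   (permsAfter-distinct n s d oks)
                   (All.tabulate (λ {p} p∈ → All.tabulate (λ {q} q∈ → different-heads p∈ q∈)))
      where
      different-heads : ∀ {p q} → p ∈ map (y ∷_) (permsOf n r) → q ∈ permsAfter n s → p ≢ q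
      different-heads p∈ q∈ with ∈-map⁻ (y ∷_) p∈ | permsAfter⁻ {n} {s} q∈
      ... | _ , _ , refl | _ , _ , _ , yr∈ , _ , refl = λ eq → All.lookup y∉ yr∈ (∷-injectiveˡ eq)

  perms-distinct : ∀ {xs} → Unique xs → AllPairs _≢_ (perms xs)
  perms-distinct = permsOf-distinct _ refl

  permsOf-complete : ∀ n {xs ys} → n ≡ length xs → Unique xs → Unique ys
                   → (∀ {z} → z ∈ ys → z ∈ xs) → (∀ {z} → z ∈ xs → z ∈ ys) → ys ∈ permsOf n xs
  permsOf-complete zero    {[]}     {[]}     _ _ _ _     _ = here refl
  permsOf-complete zero    {[]}     {y ∷ ys} _ _ _ ys⊆xs _ with ys⊆xs (here refl)
  ... | ()
  permsOf-complete zero    {_ ∷ _}  ()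
  permsOf-complete (suc n) {[]}     ()
  permsOf-complete (suc n) {x ∷ xs} {[]}     _ _ _ _ xs⊆ys with xs⊆ys (here refl)
  ... | ()
  permsOf-complete (suc n) {xs} {y ∷ ys} e uxs (y∉ys ∷ uys) ys⊆xs xs⊆ys with select-complete (ys⊆xs (here refl))
  ... | r , yr∈ = permsAfter⁺ {n} {select xs} yr∈
                    (permsOf-complete n (suc-injective (trans e (↭-length xs↭))) ur uys ys⊆r r⊆ys)
    where
    xs↭ : xs ↭ y ∷ r
    xs↭ = select-↭ yr∈
    uyr : Unique (y ∷ r)
    uyr = unique-resp-↭ xs↭ uxs
    ur : Unique r
    ur = Unique.tail uyr
    ys⊆r : ∀ {z} → z ∈ ys → z ∈ r
    ys⊆r {z} z∈ with ∈-resp-↭ xs↭ (ys⊆xs (there z∈))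
    ... | here refl = ⊥-elim (All.lookup y∉ys z∈ refl)
    ... | there z∈r = z∈r
    r⊆ys : ∀ {z} → z ∈ r → z ∈ ys
    r⊆ys {z} z∈ with xs⊆ys (∈-resp-↭ (↭-sym xs↭) (there z∈))
    ... | here refl = ⊥-elim (All.lookup (Unique.head uyr) z∈ refl)
    ... | there z∈ys = z∈ys

  perms-complete : ∀ {xs ys} → Unique xs → Unique ys
                 → (∀ {z} → z ∈ ys → z ∈ xs) → (∀ {z} → z ∈ xs → z ∈ ys) → ys ∈ perms xs
  perms-complete = permsOf-complete _ refl

  _⊗_ : List (List A) → List (List A) → List (List A)
  []       ⊗ Qs = []
  (P ∷ Ps) ⊗ Qs = map (P ++_) Qs ++ (Ps ⊗ Qs)

  length-⊗ : ∀ Ps Qs → length (Ps ⊗ Qs) ≡ length Ps * length Qs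
  length-⊗ []       Qs = refl
  length-⊗ (P ∷ Ps) Qs = trans (length-++ (map (P ++_) Qs)) (cong₂ _+_ (length-map _ Qs) (length-⊗ Ps Qs))

  ⊗⁺ : ∀ {Ps Qs P Q} → P ∈ Ps → Q ∈ Qs → P ++ Q ∈ Ps ⊗ Qs
  ⊗⁺ {P ∷ Ps}  {Qs} (here refl) Q∈ = ∈-++⁺ˡ (∈-map⁺ (P ++_) Q∈)
  ⊗⁺ {P′ ∷ Ps} {Qs} (there P∈)  Q∈ = ∈-++⁺ʳ (map (P′ ++_) Qs) (⊗⁺ P∈ Q∈)

  ⊗⁻ : ∀ {Ps Qs z} → z ∈ Ps ⊗ Qs → ∃ λ P → ∃ λ Q → P ∈ Ps × Q ∈ Qs × z ≡ P ++ Q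
  ⊗⁻ {P ∷ Ps} {Qs} z∈ with ∈-++⁻ (map (P ++_) Qs) z∈
  ... | inj₁ z∈₁ with ∈-map⁻ (P ++_) z∈₁
  ...   | Q , Q∈ , refl = P , Q , here refl , Q∈ , refl
  ⊗⁻ {P ∷ Ps} {Qs} z∈ | inj₂ z∈₂ with ⊗⁻ {Ps} {Qs} z∈₂
  ... | P′ , Q , P′∈ , Q∈ , eq = P′ , Q , there P′∈ , Q∈ , eq

  ++-prefix-equal : ∀ (P P′ Q Q′ : List A) → length P ≡ length P′ → P ++ Q ≡ P′ ++ Q′ → P ≡ P′
  ++-prefix-equal []      []        Q Q′ _ _  = refl
  ++-prefix-equal (x ∷ P) (x′ ∷ P′) Q Q′ e eq =
    cong₂ _∷_ (∷-injectiveˡ eq) (++-prefix-equal P P′ Q Q′ (suc-injective e) (∷-injectiveʳ eq))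

  ⊗-distinct : ∀ {m} Ps Qs → All (λ P → length P ≡ m) Ps → AllPairs _≢_ Ps → AllPairs _≢_ Qs
             → AllPairs _≢_ (Ps ⊗ Qs)
  ⊗-distinct []       Qs _          _          _      = []
  ⊗-distinct (P ∷ Ps) Qs (|P| ∷ |Ps|) (P∉ ∷ dPs) dQs =
    AllPairs.++⁺ (AllPairs.map⁺ (AllPairs.map (λ Q≢Q′ eq → Q≢Q′ (++-cancelˡ P _ _ eq)) dQs))
                 (⊗-distinct Ps Qs |Ps| dPs dQs)
                 (All.tabulate (λ z∈ → All.tabulate (λ z′∈ → different-prefix z∈ z′∈)))
    where
    different-prefix : ∀ {z z′} → z ∈ map (P ++_) Qs → z′ ∈ Ps ⊗ Qs → z ≢ z′
    different-prefix z∈ z′∈ with ∈-map⁻ (P ++_) z∈ | ⊗⁻ {Ps} {Qs} z′∈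
    ... | Q , _ , refl | P′ , Q′ , P′∈ , _ , refl =
      λ eq → All.lookup P∉ P′∈ (++-prefix-equal P P′ Q Q′ (trans |P| (sym (All.lookup |Ps| P′∈))) eq)

-- A cycle cannot be an interlacing of paths: its powers are defined on
-- all its digits, whereas a path is undefined at its last digit.
cycle-not-interlacing : ∀ k σs cs {σ} → σ ∈ σs → IsPath σ → Disjoint σs → ¬ Interlacing k σs (mkPC cycle cs)
cycle-not-interlacing k σs cs {mkPC _ d} σ∈ (refl , d≢[] , ud) disj (_ , digits⇔ , power) with initLast d
... | []      = d≢[] refl
... | p ∷ʳ′ x
  with iter-total (sem (mkPC cycle cs)) cs (cycle-total cs) (from (digits⇔ x) (digit-of-member σs σ∈ (∈-++⁺ʳ p (here refl)))) k
...   | z , eq , _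
  with trans (sym eq) (trans (power x) (trans (prodSem-member σs (disjoint⇒digitDisjoint disj) σ∈ (∈-++⁺ʳ p (here refl)))
                                               (next-at p x [] ud)))
...     | ()

firstOf-drop : ∀ k (l : List ℕ) {c} → firstOf (drop k l) ≡ just c → k < length l
firstOf-drop zero    (x ∷ l) _  = s≤s z≤n
firstOf-drop (suc k) (x ∷ l) eq = s≤s (firstOf-drop k l eq)

-- A factor with two consecutive digits a ↦ c forces βᵏ a = c, so the
-- path β has more than k digits.
interlacing-long : ∀ k σs ds {σ} → σ ∈ σs → IsPath σ → len σ ≢ 1 → Disjoint σs
                 → Interlacing k σs (mkPC path ds) → k < length ds
interlacing-long k σs ds {mkPC _ []}          σ∈ (_ , []≢[] , _) _   _ _ = ⊥-elim ([]≢[] refl)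
interlacing-long k σs ds {mkPC _ (a ∷ [])}    σ∈ _               ≢1  _ _ = ⊥-elim (≢1 refl)
interlacing-long k σs ds {mkPC _ (a ∷ c ∷ r)} σ∈ (refl , _)      _   disj ((_ , uds) , digits⇔ , power)
  with ∈-∃++ (from (digits⇔ a) (digit-of-member σs σ∈ (here refl)))
... | p , q , refl = ≤-trans (firstOf-drop k (a ∷ q) a↦c) (length-++-≤ʳ (a ∷ q) {p})
  where
  a↦c : firstOf (drop k (a ∷ q)) ≡ just c
  a↦c = trans (sym (iter-along p a q uds k))
          (trans (power a) (trans (prodSem-member σs (disjoint⇒digitDisjoint disj) σ∈ (here refl)) (next-head a (c ∷ r))))

unique-concat⁻ : ∀ (A : List (List ℕ)) → Unique (concat A)
               → All Unique A × AllPairs (λ c c′ → ∀ x → x ∈ c → x ∉ c′) A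
unique-concat⁻ []      _ = [] , []
unique-concat⁻ (c ∷ A) u with unique-++⁻ c u
... | uc , uA , apart with unique-concat⁻ A uA
...   | us , disj = (uc ∷ us) , (All.tabulate (λ {c′} c′∈ x x∈c x∈c′ → apart x∈c (∈-concat⁺′ x∈c′ c′∈)) ∷ disj)

disjoint⇒unique : ∀ P → Disjoint P → All (λ σ → digits σ ≢ []) P → Unique P
disjoint⇒unique []      []           []          = []
disjoint⇒unique (σ ∷ P) (apart ∷ d) (σ≢[] ∷ ne) = All.map (distinct σ≢[]) apart ∷ disjoint⇒unique P d ne
  where
  distinct : ∀ {σ τ} → digits σ ≢ [] → (∀ x → x ∈ digits σ → x ∉ digits τ) → σ ≢ τ
  distinct {mkPC _ []}      σ≢[] _     refl = σ≢[] refl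
  distinct {mkPC _ (h ∷ _)} _    apart refl = apart h (here refl) (here refl)

record ColumnsOf (k : ℕ) (σs : List PC) (β : PC) : Set where
  field
    columns   : List (List ℕ)
    isPath    : kind β ≡ path
    split     : Columns k columns (digits β)
    distinct  : Unique (pathsOf columns)
    factors⊆  : ∀ {τ} → τ ∈ pathsOf columns → τ ∈ σs
    factors⊇  : ∀ {σ} → σ ∈ σs → σ ∈ pathsOf columns

-- Every interlacing has this form: the columns of a path β whose power is
-- ∏σs give the same product, so by unique factorisation they are the σs.
interlacing-columns : ∀ k → 1 ≤ k → ∀ σs → All IsPath σs → Disjoint σs → Any (λ σ → len σ ≢ 1) σs
                    → ∀ β → Interlacing k σs β → ColumnsOf k σs β
interlacing-columns k k≥1 σs paths disj someLong (mkPC cycle cs) I with find someLong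
... | σ , σ∈ , _ = ⊥-elim (cycle-not-interlacing k σs cs σ∈ (All.lookup paths σ∈) disj I)
interlacing-columns k k≥1 σs paths disj someLong (mkPC path ds) I@((_ , uds) , digits⇔ , power) = record
  { columns  = A
  ; isPath   = refl
  ; split    = split
  ; distinct = disjoint⇒unique (pathsOf A) disjA (All.map⁺ nonempty)
  ; factors⊆ = factor-unique (pathsOf A) σs pathsA paths ddA dd (λ x → sym (same x)) coverA
  ; factors⊇ = factor-unique σs (pathsOf A) paths pathsA dd ddA same coverσs
  }
  where
  dd = disjoint⇒digitDisjoint disj
  A = proj₁ (columns-exist k k≥1 ds)
  split = proj₂ (columns-exist k k≥1 ds)
  same : ∀ x → prodSem σs x ≡ prodSem (pathsOf A) x
  same x = trans (sym (power x)) (columns-power k≥1 split uds x)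
  long : k < length ds
  long with find someLong
  ... | σ , σ∈ , ≢1 = interlacing-long k σs ds σ∈ (All.lookup paths σ∈) ≢1 disj I
  nonempty = columns-nonempty split (<⇒≤ long)
  uniqueColumns = unique-concat⁻ A (unique-resp-↭ (columns-↭ split) uds)
  disjA : Disjoint (pathsOf A)
  disjA = AllPairs.map⁺ (proj₂ uniqueColumns)
  ddA = disjoint⇒digitDisjoint disjA
  pathsA : All IsPath (pathsOf A)
  pathsA = All.map⁺ (All.zipWith (λ (ne , u) → refl , ne , u) (nonempty , proj₁ uniqueColumns))
  coverσs : ∀ x → x ∈ allDigits σs → x ∈ allDigits (pathsOf A)
  coverσs x x∈ = subst (x ∈_) (sym (allDigits-pathsOf A)) (∈-resp-↭ (columns-↭ split) (from (digits⇔ x) x∈))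
  coverA : ∀ x → x ∈ allDigits (pathsOf A) → x ∈ allDigits σs
  coverA x x∈ = to (digits⇔ x) (∈-resp-↭ (↭-sym (columns-↭ split)) (subst (x ∈_) (allDigits-pathsOf A) x∈))

ofLength : ℕ → List PC → List PC
ofLength a = filter (λ σ → len σ ≟ a)

ofLength-split : ∀ l xs → All (λ σ → len σ ≡ suc l ⊎ len σ ≡ l) xs → AllPairs (λ σ τ → len τ ≤ len σ) xs
               → xs ≡ ofLength (suc l) xs ++ ofLength l xs
ofLength-split l []       _                  _ = refl
ofLength-split l (σ ∷ xs) (inj₁ long ∷ lens) (_ ∷ sorted) =
  trans (cong (σ ∷_) (ofLength-split l xs lens sorted))
        (sym (cong₂ _++_ (filter-accept (λ τ → len τ ≟ suc l) {x = σ} {xs = xs} long)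
                         (filter-reject (λ τ → len τ ≟ l) {x = σ} {xs = xs} (λ short → 1+n≢n (trans (sym long) short)))))
ofLength-split l (σ ∷ xs) (inj₂ short ∷ lens) (below ∷ _) =
  sym (cong₂ _++_ (filter-none (λ τ → len τ ≟ suc l) {xs = σ ∷ xs} (All.map (λ e e′ → 1+n≢n {l} (trans (sym e′) e)) (short ∷ shorts)))
                  (filter-all (λ τ → len τ ≟ l) {xs = σ ∷ xs} (short ∷ shorts)))
  where
  shorts : All (λ τ → len τ ≡ l) xs
  shorts = All.zipWith (λ { (inj₁ long , τ≤σ) → ⊥-elim (1+n≰n (subst₂ _≤_ long short τ≤σ))
                          ; (inj₂ short′ , _) → short′ }) (lens , below)

ofLength-⊆ : ∀ a {xs ys} → (∀ {σ} → σ ∈ xs → σ ∈ ys) → ∀ {σ} → σ ∈ ofLength a xs → σ ∈ ofLength a ys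
ofLength-⊆ a xs⊆ys σ∈ with ∈-filter⁻ (λ τ → len τ ≟ a) σ∈
... | σ∈xs , |σ|≡a = ∈-filter⁺ (λ τ → len τ ≟ a) (xs⊆ys σ∈xs) |σ|≡a

filters-≤ : ∀ {P Q : PC → Set} (P? : ∀ σ → Dec (P σ)) (Q? : ∀ σ → Dec (Q σ))
          → (∀ {σ} → P σ → Q σ → ⊥) → ∀ xs → length (filter P? xs) + length (filter Q? xs) ≤ length xs
filters-≤ P? Q? apart []       = z≤n
filters-≤ P? Q? apart (σ ∷ xs) with P? σ | Q? σ
... | yes p | yes q = ⊥-elim (apart p q)
... | yes _ | no  _ = s≤s (filters-≤ P? Q? apart xs)
... | no  _ | yes _ = subst (_≤ suc (length xs)) (sym (+-suc (length (filter P? xs)) _)) (s≤s (filters-≤ P? Q? apart xs))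
... | no  _ | no  _ = m≤n⇒m≤1+n (filters-≤ P? Q? apart xs)

filters-cover : ∀ {P Q : PC → Set} (P? : ∀ σ → Dec (P σ)) (Q? : ∀ σ → Dec (Q σ))
              → (∀ {σ} → P σ → Q σ → ⊥) → ∀ xs
              → length (filter P? xs) + length (filter Q? xs) ≡ length xs → All (λ σ → P σ ⊎ Q σ) xs
filters-cover P? Q? apart []       _ = []
filters-cover P? Q? apart (σ ∷ xs) e with P? σ | Q? σ
... | yes p | yes q = ⊥-elim (apart p q)
... | yes p | no  _ = inj₁ p ∷ filters-cover P? Q? apart xs (suc-injective e)
... | no  _ | yes q = inj₂ q ∷ filters-cover P? Q? apart xs
                                  (suc-injective (trans (sym (+-suc (length (filter P? xs)) _)) e))
... | no  _ | no  _ = ⊥-elim (1+n≰n (subst (_≤ length xs) e (filters-≤ P? Q? apart xs)))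

-- Lists of members of σs are determined by the first digits of their members,
-- since distinct members of σs have no digit in common.
members-by-heads : ∀ σs → All IsPath σs → DigitDisjoint σs → ∀ n (p p′ : List PC)
                 → length p ≡ n → length p′ ≡ n → All (_∈ σs) p → All (_∈ σs) p′
                 → (∀ i → i < n → headAt (map digits p) i ≡ headAt (map digits p′) i) → p ≡ p′
members-by-heads σs paths dd n       []      []        _ _  _ _ _ = refl
members-by-heads σs paths dd (suc n) (σ ∷ p) (σ′ ∷ p′) e e′ (σ∈ ∷ p⊆) (σ′∈ ∷ p′⊆) heads≡ =
  cong₂ _∷_ (same-head σ σ′ σ∈ σ′∈ (All.lookup paths σ∈) (heads≡ 0 (s≤s z≤n)))
            (members-by-heads σs paths dd n p p′ (suc-injective e) (suc-injective e′) p⊆ p′⊆ (λ i i<n → heads≡ (suc i) (s≤s i<n)))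
  where
  same-head : ∀ σ σ′ → σ ∈ σs → σ′ ∈ σs → IsPath σ → firstOf (digits σ) ≡ firstOf (digits σ′) → σ ≡ σ′
  same-head (mkPC _ [])      _                 _  _   (_ , []≢[] , _) _ = ⊥-elim ([]≢[] refl)
  same-head (mkPC _ (h ∷ s)) (mkPC _ (h′ ∷ s′)) σ∈ σ′∈ _ eq with just-injective eq
  ... | refl = dd σ∈ σ′∈ (here refl) (here refl)
members-by-heads σs paths dd zero    []      (_ ∷ _)   e e′ _ _ _ with trans e (sym e′)
... | ()
members-by-heads σs paths dd zero    (_ ∷ _) _         () _ _ _ _
members-by-heads σs paths dd (suc n) []      _         () _ _ _ _
members-by-heads σs paths dd (suc n) (_ ∷ _) []        _ () _ _ _

-- The interlacings are then indexed by the arrangements: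
-- orderings of σs listing the long paths before the short ones.
module Counting (k : ℕ) (k≥1 : 1 ≤ k) (σs : List PC) (paths : All IsPath σs) (disj : Disjoint σs)
                (someLong : Any (λ σ → len σ ≢ 1) σs) (|σs|≡k : length σs ≡ k)
                (l : ℕ) (lengths : All (λ σ → len σ ≡ suc l ⊎ len σ ≡ l) σs) where

  dd : DigitDisjoint σs
  dd = disjoint⇒digitDisjoint disj

  unique-σs : Unique σs
  unique-σs = disjoint⇒unique σs disj (All.map (proj₁ ∘ proj₂) paths)

  unique-digits : Unique (allDigits σs)
  unique-digits = Unique.concat⁺ (All.map⁺ (All.map (proj₂ ∘ proj₂) paths))
                                 (AllPairs.map⁺ (AllPairs.map (λ apart {x} (x∈ , x∈′) → apart x x∈ x∈′) disj))

  digits-nonempty : allDigits σs ≢ []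
  digits-nonempty with find someLong
  ... | mkPC _ []      , σ∈ , _ = ⊥-elim (proj₁ (proj₂ (All.lookup paths σ∈)) refl)
  ... | mkPC _ (h ∷ _) , σ∈ , _ = λ eq → ¬Any[] (subst (h ∈_) eq (digit-of-member σs σ∈ (here refl)))

  longs shorts : List PC
  longs  = ofLength (suc l) σs
  shorts = ofLength l σs

  unique-longs : Unique longs
  unique-longs = Unique.filter⁺ (λ σ → len σ ≟ suc l) unique-σs

  unique-shorts : Unique shorts
  unique-shorts = Unique.filter⁺ (λ σ → len σ ≟ l) unique-σs

  longs++shorts : longs ++ shorts ↭ σs
  longs++shorts = unique-↭ (Unique.++⁺ unique-longs unique-shorts apart) unique-σs ⊆σs σs⊆
    where
    apart : ∀ {σ} → ¬ (σ ∈ longs × σ ∈ shorts)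
    apart (σ∈L , σ∈S) = 1+n≢n (trans (sym (proj₂ (∈-filter⁻ (λ σ → len σ ≟ suc l) {xs = σs} σ∈L)))
                                    (proj₂ (∈-filter⁻ (λ σ → len σ ≟ l) {xs = σs} σ∈S)))
    ⊆σs : ∀ {σ} → σ ∈ longs ++ shorts → σ ∈ σs
    ⊆σs σ∈ with ∈-++⁻ longs σ∈
    ... | inj₁ σ∈L = proj₁ (∈-filter⁻ (λ σ → len σ ≟ suc l) {xs = σs} σ∈L)
    ... | inj₂ σ∈S = proj₁ (∈-filter⁻ (λ σ → len σ ≟ l) {xs = σs} σ∈S)
    σs⊆ : ∀ {σ} → σ ∈ σs → σ ∈ longs ++ shorts
    σs⊆ σ∈ with All.lookup lengths σ∈
    ... | inj₁ long  = ∈-++⁺ˡ (∈-filter⁺ (λ σ → len σ ≟ suc l) σ∈ long)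
    ... | inj₂ short = ∈-++⁺ʳ longs (∈-filter⁺ (λ σ → len σ ≟ l) σ∈ short)

  arrangements : List (List PC)
  arrangements = perms longs ⊗ perms shorts

  interlacingOf : List PC → PC
  interlacingOf p = mkPC path (weave (length (allDigits σs)) (map digits p))

  interlacings : List PC
  interlacings = map interlacingOf arrangements

  record Woven (p : List PC) : Set where
    field
      word   : List ℕ
      split  : Columns k (map digits p) word
      weave≡ : weave (length (allDigits σs)) (map digits p) ≡ word
      p↭σs   : p ↭ σs
      word↭  : word ↭ allDigits σs

  arrangement-woven : ∀ {p} → p ∈ arrangements → Woven p
  arrangement-woven p∈ with ⊗⁻ {Ps = perms longs} {Qs = perms shorts} p∈
  ... | P , Q , P∈ , Q∈ , refl = record
    { word = word ; split = split ; weave≡ = columns-weave k≥1 split _ (≤-reflexive (↭-length word↭))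
    ; p↭σs = p↭σs ; word↭ = word↭ }
    where
    P↭ : P ↭ longs
    P↭ = perms-↭ P∈
    Q↭ : Q ↭ shorts
    Q↭ = perms-↭ Q∈
    p↭σs : P ++ Q ↭ σs
    p↭σs = ↭-trans (Perm.++⁺ P↭ Q↭) longs++shorts
    longP : All (λ c → length c ≡ suc l) (map digits P)
    longP = All.map⁺ (All-resp-↭ (↭-sym P↭) (All.all-filter (λ σ → len σ ≟ suc l) σs))
    shortQ : All (λ c → length c ≡ l) (map digits Q)
    shortQ = All.map⁺ (All-resp-↭ (↭-sym Q↭) (All.all-filter (λ σ → len σ ≟ l) σs))
    |P|+|Q|≡k : length (map digits P) + length (map digits Q) ≡ k
    |P|+|Q|≡k = begin
      length (map digits P) + length (map digits Q) ≡⟨ cong₂ _+_ (length-map digits P) (length-map digits Q) ⟩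
      length P + length Q                           ≡⟨ length-++ P ⟨
      length (P ++ Q)                               ≡⟨ ↭-length p↭σs ⟩
      length σs                                     ≡⟨ |σs|≡k ⟩
      k                                             ∎
      where open ≡-Reasoning
    woven = balanced-woven k l (map digits P) (map digits Q) longP shortQ |P|+|Q|≡k
    word = proj₁ woven
    split : Columns k (map digits (P ++ Q)) word
    split = subst (λ A → Columns k A word) (sym (map-++ digits P Q)) (proj₂ woven)
    word↭ : word ↭ allDigits σs
    word↭ = ↭-trans (columns-↭ split) (concat-↭ (Perm.map⁺ digits p↭σs))

  module _ {p} (w : Woven p) where
    open Woven w

    unique-word : Unique word
    unique-word = unique-resp-↭ (↭-sym word↭) unique-digits

    word-nonempty : word ≢ []
    word-nonempty eq = digits-nonempty (Perm.↭-empty-inv (↭-trans (↭-sym word↭) (↭-reflexive eq)))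

    -- The word of an arrangement is an interlacing: its k-th power is
    -- the product of its columns, which are the σs.
    woven-interlacing : Interlacing k σs (mkPC path word)
    woven-interlacing =
      (word-nonempty , unique-word) ,
      (λ x → mk⇔ (∈-resp-↭ word↭) (∈-resp-↭ (↭-sym word↭))) ,
      λ x → begin
        iter k (next word) x               ≡⟨ columns-power k≥1 split unique-word x ⟩
        prodSem (pathsOf (map digits p)) x ≡⟨ cong (λ q → prodSem q x) (pathsOf-digits p (All-resp-↭ (↭-sym p↭σs) paths)) ⟩
        prodSem p x                        ≡⟨ prodSem-cong p σs (digitDisjoint-⊆ dd (∈-resp-↭ p↭σs)) dd
                                                           (∈-resp-↭ p↭σs) (∈-resp-↭ (↭-sym p↭σs)) x ⟩
        prodSem σs x                       ∎
      where open ≡-Reasoning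

  arrangement-interlacing : ∀ {β} → β ∈ interlacings → Interlacing k σs β
  arrangement-interlacing β∈ with ∈-map⁻ interlacingOf β∈
  ... | p , p∈ , refl = subst (λ b → Interlacing k σs (mkPC path b)) (sym (Woven.weave≡ w)) (woven-interlacing w)
    where w = arrangement-woven p∈

  -- Distinct arrangements give distinct interlacings: equal maps force
  -- equal words, hence equal first rows, hence equal arrangements.
  different-maps : ∀ {p p′} → p ∈ arrangements → p′ ∈ arrangements → p ≢ p′
                 → ¬ SameMap (interlacingOf p) (interlacingOf p′)
  different-maps {p} {p′} p∈ p′∈ p≢p′ same =
    p≢p′ (members-by-heads σs paths dd k p p′ (|p|≡k w) (|p|≡k w′)
            (All.tabulate (∈-resp-↭ (Woven.p↭σs w))) (All.tabulate (∈-resp-↭ (Woven.p↭σs w′))) heads≡)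
    where
    w  = arrangement-woven p∈
    w′ = arrangement-woven p′∈
    |p|≡k : ∀ {q} → Woven q → length q ≡ k
    |p|≡k wq = trans (↭-length (Woven.p↭σs wq)) |σs|≡k
    words≡ : Woven.word w ≡ Woven.word w′
    words≡ = path-determined (Woven.word w) (Woven.word w′) (word-nonempty w) (unique-word w) (unique-word w′)
               (∈-resp-↭ (↭-trans (Woven.word↭ w) (↭-sym (Woven.word↭ w′))))
               (λ x → subst₂ (λ u v → next u x ≡ next v x) (Woven.weave≡ w) (Woven.weave≡ w′) (same x))
    heads≡ : ∀ i → i < k → headAt (map digits p) i ≡ headAt (map digits p′) i
    heads≡ i i<k = begin
      headAt (map digits p) i          ≡⟨ columns-head (Woven.split w) i i<k ⟨
      firstOf (drop i (Woven.word w))  ≡⟨ cong (firstOf ∘ drop i) words≡ ⟩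
      firstOf (drop i (Woven.word w′)) ≡⟨ columns-head (Woven.split w′) i i<k ⟩
      headAt (map digits p′) i         ∎
      where open ≡-Reasoning

  interlacings-distinct : AllPairs (λ α β → ¬ SameMap α β) interlacings
  interlacings-distinct = AllPairs.map⁺ (allPairs-∈ distinct-arrangements different-maps)
    where
    distinct-arrangements : AllPairs _≢_ arrangements
    distinct-arrangements = ⊗-distinct (perms longs) (perms shorts)
      (All.tabulate (λ P∈ → ↭-length (perms-↭ {xs = longs} P∈))) (perms-distinct unique-longs) (perms-distinct unique-shorts)

  -- Every interlacing is (as a map) the one of the arrangement formed by its columns.
  interlacings-complete : ∀ β → Interlacing k σs β → Any (SameMap β) interlacings
  interlacings-complete β I@((_ , uβ) , digits⇔ , _) = lose (∈-map⁺ interlacingOf arrangement) same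
    where
    open ColumnsOf (interlacing-columns k k≥1 σs paths disj someLong β I)
    p = pathsOf columns
    lens : All (λ σ → len σ ≡ suc l ⊎ len σ ≡ l) p
    lens = All.tabulate (λ σ∈ → All.lookup lengths (factors⊆ σ∈))
    sorted : AllPairs (λ σ τ → len τ ≤ len σ) p
    sorted = AllPairs.map⁺ (balanced-sorted (columns-balanced split))
    ofLength-perm : ∀ a → Unique (ofLength a σs) → ofLength a p ∈ perms (ofLength a σs)
    ofLength-perm a u = perms-complete u (Unique.filter⁺ (λ σ → len σ ≟ a) distinct)
                                       (ofLength-⊆ a factors⊆) (ofLength-⊆ a factors⊇)
    arrangement : p ∈ arrangements
    arrangement = subst (_∈ arrangements) (sym (ofLength-split l p lens sorted))
                        (⊗⁺ (ofLength-perm (suc l) unique-longs) (ofLength-perm l unique-shorts))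
    |β|≡ : length (digits β) ≡ length (allDigits σs)
    |β|≡ = ↭-length (unique-↭ uβ unique-digits (to (digits⇔ _)) (from (digits⇔ _)))
    same : SameMap β (interlacingOf p)
    same x = begin
      sem β x                                             ≡⟨ sem-path β isPath x ⟩
      next (digits β) x                                   ≡⟨ cong (λ b → next b x) (columns-weave k≥1 split _ (≤-reflexive |β|≡)) ⟨
      next (weave (length (allDigits σs)) columns) x      ≡⟨ cong (λ A → next (weave (length (allDigits σs)) A) x) (digits-pathsOf columns) ⟨
      sem (interlacingOf p) x                             ∎
      where open ≡-Reasoning

  count : PhiIs k σs (countLen (suc l) σs ! * countLen l σs !)
  count = interlacings , length-interlacings , All.tabulate arrangement-interlacing ,
          interlacings-distinct , interlacings-complete
    where
    length-interlacings : length interlacings ≡ countLen (suc l) σs ! * countLen l σs !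
    length-interlacings = begin
      length interlacings                                     ≡⟨ length-map interlacingOf arrangements ⟩
      length arrangements                                     ≡⟨ length-⊗ (perms longs) (perms shorts) ⟩
      length (perms longs) * length (perms shorts)            ≡⟨ cong₂ _*_ (length-perms longs) (length-perms shorts) ⟩
      countLen (suc l) σs ! * countLen l σs !                 ∎
      where open ≡-Reasoning

∣n-n∣≤1 : ∀ n → ∣ n - n ∣ ≤ 1
∣n-n∣≤1 n = ≤-trans (≤-reflexive (∣n-n∣≡0 n)) z≤n

within-one : ∀ n x y → (x ≡ suc n ⊎ x ≡ n) → (y ≡ suc n ⊎ y ≡ n) → ∣ x - y ∣ ≤ 1
within-one n       _ _ (inj₁ refl) (inj₁ refl) = ∣n-n∣≤1 (suc n)
within-one n       _ _ (inj₂ refl) (inj₂ refl) = ∣n-n∣≤1 n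
within-one zero    _ _ (inj₁ refl) (inj₂ refl) = ≤-refl
within-one (suc n) _ _ (inj₁ refl) (inj₂ refl) = within-one n _ _ (inj₁ refl) (inj₂ refl)
within-one zero    _ _ (inj₂ refl) (inj₁ refl) = ≤-refl
within-one (suc n) _ _ (inj₂ refl) (inj₁ refl) = within-one n _ _ (inj₂ refl) (inj₁ refl)

above-within-one : ∀ l x → l ≤ x → ∣ x - l ∣ ≤ 1 → x ≡ suc l ⊎ x ≡ l
above-within-one zero    zero          _         _        = inj₂ refl
above-within-one zero    (suc zero)    _         _        = inj₁ refl
above-within-one zero    (suc (suc x)) _         (s≤s ())
above-within-one (suc l) (suc x)       (s≤s l≤x) x∼l with above-within-one l x l≤x x∼l
... | inj₁ x≡1+l = inj₁ (cong suc x≡1+l)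
... | inj₂ x≡l   = inj₂ (cong suc x≡l)

members-within-one : ∀ σs → (∀ (i j : Fin (length σs)) → i ≢ j → ∣ len (lookup σs i) - len (lookup σs j) ∣ ≤ 1)
                   → ∀ {σ τ} → σ ∈ σs → τ ∈ σs → ∣ len σ - len τ ∣ ≤ 1
members-within-one σs close σ∈ τ∈
  rewrite lookup-index σ∈ | lookup-index τ∈ with Any.index σ∈ ≟ᶠ Any.index τ∈
... | no  i≢j  = close _ _ i≢j
... | yes i≡j  = subst (λ j → ∣ len (lookup σs (Any.index σ∈)) - len (lookup σs j) ∣ ≤ 1) i≡j (∣n-n∣≤1 (len (lookup σs (Any.index σ∈))))

-- If all lengths are within one of each other, they are l+1 or l for the
-- least length l.
two-lengths : ∀ σs {σ₀} → σ₀ ∈ σs → (∀ {σ τ} → σ ∈ σs → τ ∈ σs → ∣ len σ - len τ ∣ ≤ 1)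
            → ∃ λ l → All (λ σ → len σ ≡ suc l ⊎ len σ ≡ l) σs
two-lengths σs {σ₀} σ₀∈ close =
  len shortest ,
  All.zipWith (λ (σ∈ , l≤) → above-within-one (len shortest) _ l≤ (close σ∈ shortest∈))
              (All.tabulate id , f[argmin]≤f[xs] σ₀ σs)
  where
  shortest : PC
  shortest = argmin len σ₀ σs
  shortest∈ : shortest ∈ σs
  shortest∈ = argmin-all len σ₀∈ (All.tabulate id)

columnsOf-lengths : ∀ {k σs β} → ColumnsOf k σs β → ∃ λ n → All (λ σ → len σ ≡ suc n ⊎ len σ ≡ n) σs
columnsOf-lengths C with columns-balanced (ColumnsOf.split C)
... | n , P , Q , A≡P++Q , longP , shortQ = n , All.tabulate length-of
  where
  length-of : ∀ {σ} → σ ∈ _ → len σ ≡ suc n ⊎ len σ ≡ n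
  length-of σ∈ with ∈-map⁻ (mkPC path) (ColumnsOf.factors⊇ C σ∈)
  ... | c , c∈ , refl with ∈-++⁻ P (subst (c ∈_) A≡P++Q c∈)
  ...   | inj₁ c∈P = inj₁ (All.lookup longP c∈P)
  ...   | inj₂ c∈Q = inj₂ (All.lookup shortQ c∈Q)

-- Necessity: the columns of an interlacing are the σs, so there are k of
-- them, and their lengths differ by at most one.
interlacing⇒balanced : ∀ k → 1 ≤ k → ∀ σs → All IsPath σs → Disjoint σs → Any (λ σ → len σ ≢ 1) σs
  → (∃ λ β → Interlacing k σs β)
  → (∀ (i j : Fin (length σs)) → i ≢ j → ∣ len (lookup σs i) - len (lookup σs j) ∣ ≤ 1) × length σs ≡ k
interlacing⇒balanced k k≥1 σs paths disj someLong (β , I) =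
  (λ i j _ → within-one n _ _ (All.lookup lengths (∈-lookup i)) (All.lookup lengths (∈-lookup j))) , |σs|≡k
  where
  C = interlacing-columns k k≥1 σs paths disj someLong β I
  open ColumnsOf C
  n = proj₁ (columnsOf-lengths C)
  lengths = proj₂ (columnsOf-lengths C)
  |σs|≡k : length σs ≡ k
  |σs|≡k = begin
    length σs                ≡⟨ ↭-length (unique-↭ (disjoint⇒unique σs disj (All.map (proj₁ ∘ proj₂) paths))
                                                    distinct factors⊇ factors⊆) ⟩
    length (pathsOf columns) ≡⟨ length-map (mkPC path) columns ⟩
    length columns           ≡⟨ columns-length split ⟩
    k                        ∎
    where open ≡-Reasoning

positive-count : ∀ {k σs N} → PhiIs k σs N → 1 ≤ N → ∃ λ β → Interlacing k σs β
positive-count ([]    , refl , _     , _) ()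
positive-count (β ∷ _ , _    , I ∷ _ , _) _ = β , I

-- Sufficiency: the σs have lengths l+1 and l, and then there are
-- a! b! ≥ 1 interlacings.
balanced⇒interlacing : ∀ k → 1 ≤ k → ∀ σs → All IsPath σs → Disjoint σs → Any (λ σ → len σ ≢ 1) σs
  → (∀ (i j : Fin (length σs)) → i ≢ j → ∣ len (lookup σs i) - len (lookup σs j) ∣ ≤ 1) × length σs ≡ k
  → ∃ λ β → Interlacing k σs β
balanced⇒interlacing k k≥1 σs paths disj someLong (close , |σs|≡k) =
  positive-count {k} {σs} (Counting.count k k≥1 σs paths disj someLong |σs|≡k l lengths)
                 (*-mono-≤ (1≤n! (countLen (suc l) σs)) (1≤n! (countLen l σs)))
  where
  shape = two-lengths σs (proj₁ (proj₂ (find someLong))) (members-within-one σs close)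
  l = proj₁ shape
  lengths = proj₂ shape

path-length-nonzero : ∀ σ → IsPath σ → len σ ≢ 0
path-length-nonzero (mkPC _ [])      (_ , []≢[] , _) _ = []≢[] refl
path-length-nonzero (mkPC _ (_ ∷ _)) _               ()

count-interlacings : ∀ k → 1 ≤ k → ∀ σs → All IsPath σs → Disjoint σs → Any (λ σ → len σ ≢ 1) σs
  → ∀ (m ℓ : ℕ) → m < k → length σs ≡ k → countLen ℓ σs ≡ m → countLen (ℓ ∸ 1) σs ≡ k ∸ m
  → PhiIs k σs ((m !) * ((k ∸ m) !))
count-interlacings k k≥1 σs paths disj someLong m zero m<k |σs|≡k c₁ c₂ = ⊥-elim (1+n≰n (subst (1 ≤_) k≡0 k≥1))
  where
  none : countLen 0 σs ≡ 0
  none = cong length (filter-none (λ σ → len σ ≟ 0) (All.tabulate (λ σ∈ → path-length-nonzero _ (All.lookup paths σ∈))))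
  k≡0 : k ≡ 0
  k≡0 = begin
    k ∸ 0        ≡⟨ cong (k ∸_) (trans (sym c₁) none) ⟨
    k ∸ m        ≡⟨ c₂ ⟨
    countLen 0 σs ≡⟨ none ⟩
    0            ∎
    where open ≡-Reasoning
count-interlacings k k≥1 σs paths disj someLong m (suc l) m<k |σs|≡k c₁ c₂ =
  subst (PhiIs k σs) (cong₂ (λ a b → a ! * b !) c₁ c₂) (Counting.count k k≥1 σs paths disj someLong |σs|≡k l lengths)
  where
  lengths : All (λ σ → len σ ≡ suc l ⊎ len σ ≡ l) σs
  lengths = filters-cover (λ σ → len σ ≟ suc l) (λ σ → len σ ≟ l) (λ e e′ → 1+n≢n (trans (sym e) e′)) σs
              (trans (cong₂ _+_ c₁ c₂) (trans (m+[n∸m]≡n (<⇒≤ m<k)) (sym |σs|≡k)))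

lemma4 : (k : ℕ) → k ≥ 1 → (σs : List PC) → All IsPath σs → Disjoint σs
       → Any (λ σ → len σ ≢ 1) σs
       → ((∃ λ β → Interlacing k σs β)
           ⇔ ((∀ (i j : Fin (length σs)) → i ≢ j
                 → ∣ len (lookup σs i) - len (lookup σs j) ∣ ≤ 1)
              × length σs ≡ k))
         × (∀ (m ℓ : ℕ) → m < k → length σs ≡ k
            → countLen ℓ σs ≡ m → countLen (ℓ ∸ 1) σs ≡ k ∸ m
            → PhiIs k σs ((m !) * ((k ∸ m) !)))
lemma4 k k≥1 σs paths disj someLong =
  mk⇔ (interlacing⇒balanced k k≥1 σs paths disj someLong) (balanced⇒interlacing k k≥1 σs paths disj someLong) ,
  count-interlacings k k≥1 σs paths disj someLong
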